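{- The smallest minor-closed class of matroids that contains all Catalan matroids $M_n$ ($n\ge 0$) is the class $\mathcal{C}$ of generalized Catalan matroids.
   Context: Lattice paths start at $(0,0)$ and use steps $E=(1,0)$ and $N=(0,1)$, written as words in $\{E,N\}$. For lattice paths $P,Q$ from $(0,0)$ to $(m,r)$ with $P$ never going above $Q$, let $\mathcal{P}$ be the set of lattice paths from $(0,0)$ to $(m,r)$ going neither above $Q$ nor below $P$, and for $1\le i\le r$ let $N_i=\{j:\text{step } j \text{ is the } i\text{ -th North step of some path in }\mathcal{P}\}$; $M[P,Q]$ is the transversal matroid on $[m+r]$ with presentation $(N_1,\ldots,N_r)$. The $n$-th Catalan matroid is $M_n=M[E^nN^n,(EN)^n]$. A generalized Catalan matroid is a matroid isomorphic to $M[E^mN^r,Q]$ for some $m,r$ and lattice path $Q$ from $(0,0)$ to $(m,r)$. -}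

module Defs where

open import Data.Nat using (ℕ; zero; suc; _+_; _<_; _≤_)
open import Data.Bool using (Bool; true; false; if_then_else_)
open import Data.Fin using (Fin; toℕ)
open import Data.Fin.Subset using (Subset; _∈_; _∉_; _⊆_; ∣_∣; _∪_; ⁅_⁆; ⊥; inside; outside)
open import Data.Vec using (Vec; []; _∷_; lookup; tabulate; replicate; _++_)
open import Data.Product using (Σ; ∃; _×_; _,_)
open import Relation.Binary.PropositionalEquality using (_≡_)
open import Function.Bundles using (_⇔_)

record IndepSystem : Set₁ where
  field
    size  : ℕ
    Indep : Subset size → Set
open IndepSystem public

record IsMatroid (M : IndepSystem) : Set where
  field
    indep-∅   : Indep M ⊥
    indep-⊆   : ∀ {I J} → I ⊆ J → Indep M J → Indep M I
    augment   : ∀ {I J} → Indep M I → Indep M J → ∣ I ∣ < ∣ J ∣ →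
                ∃ λ x → x ∈ J × x ∉ I × Indep M (I ∪ ⁅ x ⁆)

IsBasisOf : (M : IndepSystem) → Subset (size M) → Subset (size M) → Set
IsBasisOf M C B =
  B ⊆ C × Indep M B ×
  (∀ B' → B ⊆ B' → B' ⊆ C → Indep M B' → B' ≡ B)

-- Each element of E(M) is either kept (and
-- then identified bijectively with an element of E(N)), contracted, or
-- deleted.  N ≅ M / C \ D where C = contracted, D = deleted elements.

data Role (k : ℕ) : Set where
  keep     : Fin k → Role k
  contract : Role k
  delete   : Role k

roleMember : ∀ {k} → Role k → Subset k → Bool
roleMember (keep i) X = lookup X i
roleMember contract X = outside
roleMember delete   X = outside

isContract : ∀ {k} → Role k → Bool
isContract (keep _) = false
isContract contract = true
isContract delete   = false

embed : ∀ {n k} → (Fin n → Role k) → Subset k → Subset n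
embed τ X = tabulate (λ j → roleMember (τ j) X)

contractSet : ∀ {n k} → (Fin n → Role k) → Subset n
contractSet τ = tabulate (λ j → isContract (τ j))

-- N is (isomorphic to) a minor of M.
-- Independence in M / C: I is independent iff I ∪ B is independent in M
-- for some basis B of C.
record Minor (N M : IndepSystem) : Set where
  field
    τ     : Fin (size M) → Role (size N)
    surj  : ∀ i → ∃ λ j → τ j ≡ keep i
    inj   : ∀ {i j j'} → τ j ≡ keep i → τ j' ≡ keep i → j ≡ j'
    indep : ∀ X → Indep N X ⇔
              (∃ λ B → IsBasisOf M (contractSet τ) B × Indep M (embed τ X ∪ B))

Iso : IndepSystem → IndepSystem → Set
Iso N M = Σ (Minor N M) λ μ → ∀ j → ∃ λ i → Minor.τ μ j ≡ keep i

-- A class of matroids is minor-closed (hence also closed under isomorphism).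
MinorClosed : (IndepSystem → Set) → Set₁
MinorClosed P = ∀ M N → IsMatroid M → P M → Minor N M → P N

-- Lattice paths: words in {E,N}; a path from (0,0) to (m,r) is a word of
-- length m + r with exactly r North steps.

data Step : Set where
  E N : Step

isN : Step → ℕ
isN E = 0
isN N = 1

countN : ∀ {k} → Vec Step k → ℕ
countN []      = 0
countN (s ∷ v) = isN s + countN v

nUpTo : ∀ {k} → Vec Step k → ℕ → ℕ
nUpTo []      t       = 0
nUpTo (s ∷ v) zero    = 0
nUpTo (s ∷ v) (suc t) = isN s + nUpTo v t

IsPath : (m r : ℕ) → Vec Step (m + r) → Set
IsPath m r R = countN R ≡ r

-- R never goes above Q (for paths with equal endpoints: after every
-- number t of steps, R has made at most as many North steps as Q).
NotAbove : ∀ {k} → Vec Step k → Vec Step k → Set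
NotAbove R Q = ∀ t → nUpTo R t ≤ nUpTo Q t

InRegion : ∀ {m r} → (P Q : Vec Step (m + r)) → Vec Step (m + r) → Set
InRegion {m} {r} P Q R = IsPath m r R × NotAbove R Q × NotAbove P R

-- N_i (i counted from 0, positions j counted from 0):
-- step j is the (i+1)-th North step of some path in 𝒫.
NSet : ∀ {m r} → (P Q : Vec Step (m + r)) → Fin r → Fin (m + r) → Set
NSet {m} {r} P Q i j =
  ∃ λ R → InRegion {m} {r} P Q R × lookup R j ≡ N × nUpTo R (toℕ j) ≡ toℕ i

-- Transversal matroid M[P,Q] with presentation (N_1,…,N_r):
-- independent sets are the partial transversals.
MPQ : ∀ {m r} → (P Q : Vec Step (m + r)) → IndepSystem
MPQ {m} {r} P Q = record
  { size  = m + r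
  ; Indep = λ X →
      Σ ((x : Fin (m + r)) → x ∈ X → Fin r) λ φ →
        (∀ x (h : x ∈ X) → NSet {m} {r} P Q (φ x h) x) ×
        (∀ x y (hx : x ∈ X) (hy : y ∈ X) → φ x hx ≡ φ y hy → x ≡ y)
  }

EmNr : (m r : ℕ) → Vec Step (m + r)
EmNr m r = replicate m E ++ replicate r N

even : ℕ → Bool
even zero          = true
even (suc zero)    = false
even (suc (suc n)) = even n

ENpow : (n : ℕ) → Vec Step (n + n)
ENpow n = tabulate (λ j → if even (toℕ j) then E else N)

Catalan : ℕ → IndepSystem
Catalan n = MPQ {n} {n} (EmNr n n) (ENpow n)

GenCatalan : IndepSystem → Set
GenCatalan M = ∃ λ m → ∃ λ r → Σ (Vec Step (m + r)) λ Q →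
  IsPath m r Q × Iso M (MPQ {m} {r} (EmNr m r) Q)

-- For a lattice path Q from (0,0) to (m,r), a set X of steps is independent in
-- M[E^m N^r, Q] exactly when every prefix of length t contains at most nUpTo Q t
-- elements of X. Systems cut out by such prefix bounds are matroids for any bound.
-- Contracting a set C lowers the bound by the prefix counts of the greedy (rightmost)
-- basis of C, deleting just forgets positions, and after renumbering the surviving
-- elements the bound can be replaced by the largest bound with unit steps, which is the
-- north count of a lattice path; so minors of generalized Catalan matroids are
-- generalized Catalan. Conversely M[E^m N^r, Q] is a minor of M_(m+r+1): interleave its
-- elements with the north steps of (EN)^(m+r+1), contracting the north step before
-- element j when Q_j = E and deleting it when Q_j = N.

module Submission where

open import Defs
open import Data.Nat using (ℕ; zero; suc; _+_; _∸_; _≤_; _<_; z≤n; s≤s; _⊓_; _≤?_; _<?_; ⌊_/2⌋)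
open import Data.Nat.Properties
open import Data.Nat.Solver using (module +-*-Solver)
open import Data.Bool using (Bool; true; false; not; _∧_; _∨_; if_then_else_)
open import Data.Bool.Properties using (∨-identityʳ)
open import Data.Fin using (Fin; toℕ; fromℕ<) renaming (zero to fzero; suc to fsuc)
import Data.Fin.Properties as Fin
open import Data.Fin.Subset using (Subset; _∈_; _∉_; _⊆_; ∣_∣; _∪_; ⁅_⁆; ⊥)
open import Data.Fin.Subset.Properties
  using (∣⁅x⁆∣≡1; ∪-identityʳ; p⊆p∪q; q⊆p∪q; ⊆-antisym; ⊥⊆; ∉⊥; x∈⁅x⁆; x∈⁅y⁆⇒x≡y; x∈p∪q⁻; drop-∷-⊆; p⊆q⇒∣p∣≤∣q∣)
open import Data.Vec using (Vec; []; _∷_; lookup; tabulate; replicate; _++_; map; here; there)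
import Data.Vec.Properties as Vec
open import Data.Product using (Σ; ∃; _×_; _,_; proj₁; proj₂; map₂) renaming (map to map-×)
open import Data.Sum using (_⊎_; inj₁; inj₂)
open import Relation.Nullary using (Dec; yes; no; does; ¬_; contradiction)
open import Relation.Nullary.Decidable using (map′)
open import Relation.Binary.Definitions using (tri<; tri≈; tri>)
open import Relation.Binary.PropositionalEquality
open import Algebra.Properties.CommutativeSemigroup +-commutativeSemigroup using (interchange; xy∙z≈xz∙y)
open import Function using (_∘_; id; case_of_)
open import Function.Bundles using (_⇔_; mk⇔; Equivalence)
open import Function.Construct.Composition using (_⇔-∘_)
open import Function.Construct.Symmetry using (⇔-sym)

open +-*-Solver using (solve; _:+_; _:=_)
open Equivalence using (to; from)

-- Counting along prefixes

bit : Bool → ℕ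
bit true  = 1
bit false = 0

bit≤1 : ∀ b → bit b ≤ 1
bit≤1 true  = ≤-refl
bit≤1 false = z≤n

bit-mono : ∀ {a b} → (a ≡ true → b ≡ true) → bit a ≤ bit b
bit-mono {false} _   = z≤n
bit-mono {true}  a⇒b rewrite a⇒b refl = ≤-refl

bit-∨ : ∀ a b → bit (a ∨ b) ≤ bit a + bit b
bit-∨ true  _ = s≤s z≤n
bit-∨ false _ = ≤-refl

bit-∨-disjoint : ∀ a b → (a ≡ true → b ≡ false) → bit (a ∨ b) ≡ bit a + bit b
bit-∨-disjoint true  _ a⇒¬b rewrite a⇒¬b refl = refl
bit-∨-disjoint false _ _ = refl

count : (ℕ → Bool) → ℕ → ℕ
count g zero    = 0
count g (suc t) = bit (g 0) + count (λ p → g (suc p)) t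

count-snoc : ∀ g t → count g (suc t) ≡ count g t + bit (g t)
count-snoc g zero    = +-comm (bit (g 0)) 0
count-snoc g (suc t) = trans (cong (bit (g 0) +_) (count-snoc (λ p → g (suc p)) t))
                             (sym (+-assoc (bit (g 0)) _ _))

count-cong : ∀ {g h} t → (∀ p → p < t → g p ≡ h p) → count g t ≡ count h t
count-cong zero    _   = refl
count-cong (suc t) g≗h = cong₂ _+_ (cong bit (g≗h 0 (s≤s z≤n)))
                                   (count-cong t (λ p p<t → g≗h (suc p) (s≤s p<t)))

count-false : ∀ {g} t → (∀ p → g p ≡ false) → count g t ≡ 0
count-false zero    _  = refl
count-false {g} (suc t) ¬g rewrite ¬g 0 = count-false t (λ p → ¬g (suc p))

count≤ : ∀ g t → count g t ≤ t
count≤ g zero    = z≤n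
count≤ g (suc t) = +-mono-≤ (bit≤1 (g 0)) (count≤ _ t)

count-monoˡ : ∀ {g h} t → (∀ p → g p ≡ true → h p ≡ true) → count g t ≤ count h t
count-monoˡ zero    _   = z≤n
count-monoˡ (suc t) g⇒h = +-mono-≤ (bit-mono (g⇒h 0)) (count-monoˡ t (λ p → g⇒h (suc p)))

count-monoʳ : ∀ g {t u} → t ≤ u → count g t ≤ count g u
count-monoʳ g {zero}  _         = z≤n
count-monoʳ g {suc t} (s≤s t≤u) = +-monoʳ-≤ (bit (g 0)) (count-monoʳ _ t≤u)

count-strict : ∀ g {a b} → g a ≡ true → a < b → count g a < count g b
count-strict g {a} {b} ga a<b = begin-strict
  count g a             <⟨ m<m+n (count g a) (s≤s z≤n) ⟩
  count g a + bit true  ≡⟨ cong (λ z → count g a + bit z) ga ⟨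
  count g a + bit (g a) ≡⟨ count-snoc g a ⟨
  count g (suc a)       ≤⟨ count-monoʳ g a<b ⟩
  count g b             ∎
  where open ≤-Reasoning

count≤count+∸ : ∀ g t u → count g u ≤ count g t + (u ∸ t)
count≤count+∸ g zero    u       = count≤ g u
count≤count+∸ g (suc t) zero    = z≤n
count≤count+∸ g (suc t) (suc u) rewrite +-assoc (bit (g 0)) (count (λ p → g (suc p)) t) (u ∸ t) =
  +-monoʳ-≤ (bit (g 0)) (count≤count+∸ _ t u)

count-∨ : ∀ g h t → count (λ p → g p ∨ h p) t ≤ count g t + count h t
count-∨ g h zero    = z≤n
count-∨ g h (suc t) = ≤-trans (+-mono-≤ (bit-∨ (g 0) (h 0)) (count-∨ _ _ t))
  (≤-reflexive (interchange (bit (g 0)) (bit (h 0)) (count (λ p → g (suc p)) t) (count (λ p → h (suc p)) t)))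

count-∨-disjoint : ∀ g h t → (∀ p → g p ≡ true → h p ≡ false) →
                   count (λ p → g p ∨ h p) t ≡ count g t + count h t
count-∨-disjoint g h zero    _        = refl
count-∨-disjoint g h (suc t) disjoint =
  trans (cong₂ _+_ (bit-∨-disjoint (g 0) (h 0) (disjoint 0)) (count-∨-disjoint _ _ t (λ p → disjoint (suc p))))
        (interchange (bit (g 0)) (bit (h 0)) (count (λ p → g (suc p)) t) (count (λ p → h (suc p)) t))

count-complement : ∀ g t → count (not ∘ g) t + count g t ≡ t
count-complement g zero    = refl
count-complement g (suc t) = trans (interchange (bit (not (g 0))) _ (bit (g 0)) _)
                                   (cong₂ _+_ (bit-not (g 0)) (count-complement _ t))
  where
  bit-not : ∀ b → bit (not b) + bit b ≡ 1
  bit-not true  = refl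
  bit-not false = refl

χ : ∀ {n} → Subset n → ℕ → Bool
χ []      p       = false
χ (b ∷ V) zero    = b
χ (b ∷ V) (suc p) = χ V p

χ-toℕ : ∀ {n} (V : Subset n) x → χ V (toℕ x) ≡ lookup V x
χ-toℕ (b ∷ V) fzero    = refl
χ-toℕ (b ∷ V) (fsuc x) = χ-toℕ V x

χ-fromℕ< : ∀ {n} (V : Subset n) p (p<n : p < n) → χ V p ≡ lookup V (fromℕ< p<n)
χ-fromℕ< (b ∷ V) zero    _         = refl
χ-fromℕ< (b ∷ V) (suc p) (s≤s p<n) = χ-fromℕ< V p p<n

χ-beyond : ∀ {n} (V : Subset n) p → n ≤ p → χ V p ≡ false
χ-beyond []      p       _         = refl
χ-beyond (b ∷ V) (suc p) (s≤s n≤p) = χ-beyond V p n≤p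

∈⇒χ : ∀ {n} {V : Subset n} {x} → x ∈ V → χ V (toℕ x) ≡ true
∈⇒χ here      = refl
∈⇒χ (there x∈V) = ∈⇒χ x∈V

χ⇒∈ : ∀ {n} (V : Subset n) x → χ V (toℕ x) ≡ true → x ∈ V
χ⇒∈ (true ∷ V) fzero    _ = here
χ⇒∈ (b ∷ V)    (fsuc x) e = there (χ⇒∈ V x e)

χ-element : ∀ {n} (V : Subset n) p → χ V p ≡ true → Σ (Fin n) λ x → toℕ x ≡ p × x ∈ V
χ-element (true ∷ V) zero    _ = fzero , refl , here
χ-element (b ∷ V)    (suc p) e with χ-element V p e
... | x , refl , x∈V = fsuc x , refl , there x∈V

⊆⇒χ : ∀ {n} {I J : Subset n} → I ⊆ J → ∀ p → χ I p ≡ true → χ J p ≡ true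
⊆⇒χ {I = I} I⊆J p e with χ-element I p e
... | x , refl , x∈I = ∈⇒χ (I⊆J x∈I)

χ⇒⊆ : ∀ {n} {I J : Subset n} → (∀ p → χ I p ≡ true → χ J p ≡ true) → I ⊆ J
χ⇒⊆ {J = J} I⇒J {x} x∈I = χ⇒∈ J x (I⇒J (toℕ x) (∈⇒χ x∈I))

χ-∪ : ∀ {n} (V W : Subset n) p → χ (V ∪ W) p ≡ (χ V p ∨ χ W p)
χ-∪ []      []      p       = refl
χ-∪ (a ∷ V) (b ∷ W) zero    = refl
χ-∪ (a ∷ V) (b ∷ W) (suc p) = χ-∪ V W p

χ-⊥ : ∀ n p → χ (⊥ {n}) p ≡ false
χ-⊥ zero    p       = refl
χ-⊥ (suc n) zero    = refl
χ-⊥ (suc n) (suc p) = χ-⊥ n p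

χ-⁅x⁆ : ∀ {n} (x : Fin n) p → χ ⁅ x ⁆ p ≡ true → p ≡ toℕ x
χ-⁅x⁆ {suc n} fzero    zero    _ = refl
χ-⁅x⁆ {suc n} fzero    (suc p) e rewrite χ-⊥ n p = case e of λ ()
χ-⁅x⁆ {suc n} (fsuc x) (suc p) e = cong suc (χ-⁅x⁆ x p e)

count-χ-⊥ : ∀ n t → count (χ (⊥ {n})) t ≡ 0
count-χ-⊥ n t = count-false t (χ-⊥ n)

∣∣≡count-χ : ∀ {n} (V : Subset n) → ∣ V ∣ ≡ count (χ V) n
∣∣≡count-χ []          = refl
∣∣≡count-χ (true ∷ V)  = cong suc (∣∣≡count-χ V)
∣∣≡count-χ (false ∷ V) = ∣∣≡count-χ V

count-χ-saturates : ∀ {n} (V : Subset n) t → n ≤ t → count (χ V) t ≡ count (χ V) n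
count-χ-saturates []      t       _         = count-false t (λ _ → refl)
count-χ-saturates (b ∷ V) (suc t) (s≤s n≤t) = cong (bit b +_) (count-χ-saturates V t n≤t)

count-χ≤∣∣ : ∀ {n} (V : Subset n) t → count (χ V) t ≤ ∣ V ∣
count-χ≤∣∣ {n} V t with t ≤? n
... | yes t≤n = subst (count (χ V) t ≤_) (sym (∣∣≡count-χ V)) (count-monoʳ (χ V) t≤n)
... | no  t≰n = ≤-reflexive (trans (count-χ-saturates V t (≰⇒≥ t≰n)) (sym (∣∣≡count-χ V)))

count-attains : ∀ g t q → q < count g t → ∃ λ p → p < t × g p ≡ true × count g p ≡ q
count-attains g zero    q ()
count-attains g (suc t) q q<count with q <? count g t | g t in gt
... | yes q<count′ | _ with count-attains g t q q<count′
...   | p , p<t , gp , count≡q = p , m≤n⇒m≤1+n p<t , gp , count≡q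
count-attains g (suc t) q q<count | no q≮count | true =
  t , ≤-refl , gt , ≤-antisym (≮⇒≥ q≮count) (≤-pred (subst (q <_) count-step q<count))
  where
  count-step : count g (suc t) ≡ suc (count g t)
  count-step = trans (count-snoc g t) (trans (cong (λ b → count g t + bit b) gt) (+-comm _ 1))
count-attains g (suc t) q q<count | no q≮count | false =
  contradiction (subst (q <_) count-same q<count) q≮count
  where
  count-same : count g (suc t) ≡ count g t
  count-same = trans (count-snoc g t) (trans (cong (λ b → count g t + bit b) gt) (+-identityʳ _))

count-χ≤-injection : ∀ {n u} (X : Subset n) t (f : ∀ x → x ∈ X → toℕ x < t → Fin u) →
                     (∀ x y x∈X y∈X x<t y<t → f x x∈X x<t ≡ f y y∈X y<t → x ≡ y) →
                     count (χ X) t ≤ u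
count-χ≤-injection {n} {u} X t f f-injective = Fin.injective⇒≤ {f = F} F-injective
  where
  record Element (i : Fin (count (χ X) t)) : Set where
    field
      x       : Fin n
      x∈X     : x ∈ X
      x<t     : toℕ x < t
      count-x : count (χ X) (toℕ x) ≡ toℕ i
  element : ∀ i → Element i
  element i with count-attains (χ X) t (toℕ i) (Fin.toℕ<n i)
  ... | p , p<t , χp , count≡i with χ-element X p χp
  ...   | x , refl , x∈X = record { x = x ; x∈X = x∈X ; x<t = p<t ; count-x = count≡i }
  F : Fin (count (χ X) t) → Fin u
  F i = f x x∈X x<t where open Element (element i)
  F-injective : ∀ {i j} → F i ≡ F j → i ≡ j
  F-injective {i} {j} Fi≡Fj = Fin.toℕ-injective (begin
    toℕ i                     ≡⟨ Element.count-x (element i) ⟨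
    count (χ X) (toℕ (x ei))  ≡⟨ cong (λ y → count (χ X) (toℕ y)) same ⟩
    count (χ X) (toℕ (x ej))  ≡⟨ Element.count-x (element j) ⟩
    toℕ j                     ∎)
    where
    open ≡-Reasoning
    open Element using (x; x∈X; x<t)
    ei : Element i
    ei = element i
    ej : Element j
    ej = element j
    same : x ei ≡ x ej
    same = f-injective (x ei) (x ej) (x∈X ei) (x∈X ej) (x<t ei) (x<t ej) Fi≡Fj

count-injective : ∀ g {a b} → g a ≡ true → g b ≡ true → count g a ≡ count g b → a ≡ b
count-injective g {a} {b} ga gb eq with <-cmp a b
... | tri< a<b _ _ = contradiction eq (<⇒≢ (count-strict g ga a<b))
... | tri≈ _ a≡b _ = a≡b
... | tri> _ _ b<a = contradiction (sym eq) (<⇒≢ (count-strict g gb b<a))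

-- Prefix-bounded set systems

Bounded : ∀ {n} → (ℕ → ℕ) → Subset n → Set
Bounded {n} c X = ∀ t → t ≤ n → count (χ X) t ≤ c t

boundedSystem : ℕ → (ℕ → ℕ) → IndepSystem
boundedSystem n c = record { size = n ; Indep = Bounded {n} c }

record LastExcess (g h : ℕ → Bool) (t : ℕ) : Set where
  field
    pos       : ℕ
    pos<t     : pos < t
    g-pos     : g pos ≡ true
    h-pos     : h pos ≡ false
    g⇒h-after : ∀ q → pos < q → q < t → g q ≡ true → h q ≡ true

excess? : ∀ a b → (a ≡ true × b ≡ false) ⊎ (a ≡ true → b ≡ true)
excess? true  false = inj₁ (refl , refl)
excess? true  true  = inj₂ (λ _ → refl)
excess? false _     = inj₂ (λ ())

lastExcess : ∀ g h t → count h t < count g t → LastExcess g h t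
lastExcess g h zero    ()
lastExcess g h (suc t) h<g with excess? (g t) (h t)
... | inj₁ (gt , ht) = record
  { pos = t ; pos<t = ≤-refl ; g-pos = gt ; h-pos = ht
  ; g⇒h-after = λ q t<q q<1+t _ → contradiction (≤-pred q<1+t) (<⇒≱ t<q) }
... | inj₂ g⇒h = record
  { pos = pos ; pos<t = m≤n⇒m≤1+n pos<t ; g-pos = g-pos ; h-pos = h-pos
  ; g⇒h-after = after }
  where
  h<g-before : count h t < count g t
  h<g-before = +-cancelʳ-< (bit (h t)) _ _ (begin-strict
    count h t + bit (h t) ≡⟨ count-snoc h t ⟨
    count h (suc t)       <⟨ h<g ⟩
    count g (suc t)       ≡⟨ count-snoc g t ⟩
    count g t + bit (g t) ≤⟨ +-monoʳ-≤ (count g t) (bit-mono g⇒h) ⟩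
    count g t + bit (h t) ∎)
    where open ≤-Reasoning
  open LastExcess (lastExcess g h t h<g-before)
  after : ∀ q → pos < q → q < suc t → g q ≡ true → h q ≡ true
  after q pos<q q<1+t with m≤n⇒m<n∨m≡n (≤-pred q<1+t)
  ... | inj₁ q<t  = g⇒h-after q pos<q q<t
  ... | inj₂ refl = g⇒h

count-suffix-mono : ∀ g h u k → (∀ q → u ≤ q → q < u + k → g q ≡ true → h q ≡ true) →
                    count g (u + k) + count h u ≤ count h (u + k) + count g u
count-suffix-mono g h u zero    _   rewrite +-identityʳ u = ≤-reflexive (+-comm (count g u) (count h u))
count-suffix-mono g h u (suc k) g⇒h = begin
  count g (u + suc k) + count h u                  ≡⟨ cong (λ v → count g v + count h u) (+-suc u k) ⟩
  count g (suc (u + k)) + count h u                ≡⟨ cong (_+ count h u) (count-snoc g (u + k)) ⟩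
  count g (u + k) + bit (g (u + k)) + count h u    ≡⟨ xy∙z≈xz∙y (count g (u + k)) _ _ ⟩
  count g (u + k) + count h u + bit (g (u + k))    ≤⟨ +-mono-≤ previous (bit-mono (g⇒h (u + k) (m≤m+n u k) u+k<u+1+k)) ⟩
  count h (u + k) + count g u + bit (h (u + k))    ≡⟨ xy∙z≈xz∙y (count h (u + k)) _ _ ⟩
  count h (u + k) + bit (h (u + k)) + count g u    ≡⟨ cong (_+ count g u) (count-snoc h (u + k)) ⟨
  count h (suc (u + k)) + count g u                ≡⟨ cong (λ v → count h v + count g u) (+-suc u k) ⟨
  count h (u + suc k) + count g u                  ∎
  where
  open ≤-Reasoning
  u+k<u+1+k : u + k < u + suc k
  u+k<u+1+k = +-monoʳ-< u ≤-refl
  previous : count g (u + k) + count h u ≤ count h (u + k) + count g u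
  previous = count-suffix-mono g h u k (λ q u≤q q<u+k → g⇒h q u≤q (<-trans q<u+k u+k<u+1+k))

count-χ-∪ : ∀ {n} (V W : Subset n) t → count (χ (V ∪ W)) t ≤ count (χ V) t + count (χ W) t
count-χ-∪ V W t = ≤-trans (≤-reflexive (count-cong t (λ p _ → χ-∪ V W p))) (count-∨ (χ V) (χ W) t)

count-χ-⁅x⁆-before : ∀ {n} (x : Fin n) u → u ≤ toℕ x → count (χ ⁅ x ⁆) u ≡ 0
count-χ-⁅x⁆-before x u u≤x = trans (count-cong u not-x) (count-false u (λ _ → refl))
  where
  not-x : ∀ p → p < u → χ ⁅ x ⁆ p ≡ false
  not-x p p<u with χ ⁅ x ⁆ p in e
  ... | false = refl
  ... | true  = contradiction (χ-⁅x⁆ x p e) (<⇒≢ (<-≤-trans p<u u≤x))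

count-χ-⁅x⁆≤1 : ∀ {n} (x : Fin n) u → count (χ ⁅ x ⁆) u ≤ 1
count-χ-⁅x⁆≤1 x u = subst (count (χ ⁅ x ⁆) u ≤_) (∣⁅x⁆∣≡1 x) (count-χ≤∣∣ ⁅ x ⁆ u)

-- x is the last element of J outside I; beyond x every element of J lies in I, so I
-- stays strictly behind J on every longer prefix and x can be added.
augment-bounded : ∀ {n} c {I J : Subset n} → Bounded c I → Bounded c J → ∣ I ∣ < ∣ J ∣ →
                  ∃ λ x → x ∈ J × x ∉ I × Bounded c (I ∪ ⁅ x ⁆)
augment-bounded {n} c {I} {J} bI bJ ∣I∣<∣J∣ = x , x∈J , x∉I , bounded
  where
  I<J : count (χ I) n < count (χ J) n
  I<J = subst₂ _<_ (∣∣≡count-χ I) (∣∣≡count-χ J) ∣I∣<∣J∣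
  open LastExcess (lastExcess (χ J) (χ I) n I<J)
  x : Fin n
  x = fromℕ< pos<t
  x≡pos : toℕ x ≡ pos
  x≡pos = Fin.toℕ-fromℕ< pos<t
  x∈J : x ∈ J
  x∈J = χ⇒∈ J x (trans (cong (χ J) x≡pos) g-pos)
  x∉I : x ∉ I
  x∉I x∈I with trans (sym (∈⇒χ x∈I)) (trans (cong (χ I) x≡pos) h-pos)
  ... | ()
  I<J-after : ∀ u → pos < u → u ≤ n → count (χ I) u < count (χ J) u
  I<J-after u pos<u u≤n = +-cancelˡ-< (count (χ J) n) _ _ (begin-strict
    count (χ J) n + count (χ I) u       ≡⟨ cong (λ v → count (χ J) v + count (χ I) u) u+k≡n ⟨
    count (χ J) (u + k) + count (χ I) u ≤⟨ count-suffix-mono (χ J) (χ I) u k J⇒I ⟩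
    count (χ I) (u + k) + count (χ J) u ≡⟨ cong (λ v → count (χ I) v + count (χ J) u) u+k≡n ⟩
    count (χ I) n + count (χ J) u       <⟨ +-monoˡ-< (count (χ J) u) I<J ⟩
    count (χ J) n + count (χ J) u       ∎)
    where
    open ≤-Reasoning
    k : ℕ
    k = n ∸ u
    u+k≡n : u + k ≡ n
    u+k≡n = m+[n∸m]≡n u≤n
    J⇒I : ∀ q → u ≤ q → q < u + k → χ J q ≡ true → χ I q ≡ true
    J⇒I q u≤q q<u+k = g⇒h-after q (<-≤-trans pos<u u≤q) (subst (q <_) u+k≡n q<u+k)
  bounded : Bounded c (I ∪ ⁅ x ⁆)
  bounded u u≤n = ≤-trans (count-χ-∪ I ⁅ x ⁆ u) (by-position (u ≤? pos))
    where
    by-position : Dec (u ≤ pos) → count (χ I) u + count (χ ⁅ x ⁆) u ≤ c u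
    by-position (yes u≤pos) = begin
      count (χ I) u + count (χ ⁅ x ⁆) u
        ≡⟨ cong (count (χ I) u +_) (count-χ-⁅x⁆-before x u (subst (u ≤_) (sym x≡pos) u≤pos)) ⟩
      count (χ I) u + 0
        ≡⟨ +-identityʳ _ ⟩
      count (χ I) u
        ≤⟨ bI u u≤n ⟩
      c u ∎
      where open ≤-Reasoning
    by-position (no u≰pos) = begin
      count (χ I) u + count (χ ⁅ x ⁆) u ≤⟨ +-monoʳ-≤ (count (χ I) u) (count-χ-⁅x⁆≤1 x u) ⟩
      count (χ I) u + 1                 ≡⟨ +-comm _ 1 ⟩
      suc (count (χ I) u)               ≤⟨ I<J-after u (≰⇒> u≰pos) u≤n ⟩
      count (χ J) u                     ≤⟨ bJ u u≤n ⟩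
      c u                               ∎
      where open ≤-Reasoning

boundedSystem-isMatroid : ∀ n c → IsMatroid (boundedSystem n c)
boundedSystem-isMatroid n c = record
  { indep-∅ = λ t _ → subst (_≤ c t) (sym (count-χ-⊥ n t)) z≤n
  ; indep-⊆ = λ I⊆J bJ t t≤n → ≤-trans (count-monoˡ t (⊆⇒χ I⊆J)) (bJ t t≤n)
  ; augment = augment-bounded c
  }

∣p∪⁅x⁆∣≡1+∣p∣ : ∀ {n} (p : Subset n) (x : Fin n) → x ∉ p → ∣ p ∪ ⁅ x ⁆ ∣ ≡ suc ∣ p ∣
∣p∪⁅x⁆∣≡1+∣p∣ (false ∷ p) fzero    _   = cong (λ q → suc ∣ q ∣) (∪-identityʳ p)
∣p∪⁅x⁆∣≡1+∣p∣ (true  ∷ p) fzero    x∉p = contradiction here x∉p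
∣p∪⁅x⁆∣≡1+∣p∣ (true  ∷ p) (fsuc x) x∉p = cong suc (∣p∪⁅x⁆∣≡1+∣p∣ p x (λ x∈p → x∉p (there x∈p)))
∣p∪⁅x⁆∣≡1+∣p∣ (false ∷ p) (fsuc x) x∉p = ∣p∪⁅x⁆∣≡1+∣p∣ p x (λ x∈p → x∉p (there x∈p))

extend-independent : ∀ {M} → IsMatroid M → ∀ {I J} → Indep M I → Indep M J → ∣ I ∣ ≤ ∣ J ∣ →
                     ∃ λ B → I ⊆ B × Indep M B × ∣ B ∣ ≡ ∣ J ∣
extend-independent {M} isM {I} {J} iI iJ ∣I∣≤∣J∣ = go (∣ J ∣ ∸ ∣ I ∣) I (m+[n∸m]≡n ∣I∣≤∣J∣) iI
  where
  open IsMatroid isM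
  go : ∀ k I → ∣ I ∣ + k ≡ ∣ J ∣ → Indep M I → ∃ λ B → I ⊆ B × Indep M B × ∣ B ∣ ≡ ∣ J ∣
  go zero    I ∣I∣≡∣J∣ iI = I , (λ x∈I → x∈I) , iI , trans (sym (+-identityʳ _)) ∣I∣≡∣J∣
  go (suc k) I ∣I∣+1+k≡∣J∣ iI with augment iI iJ (subst (∣ I ∣ <_) ∣I∣+1+k≡∣J∣ (m<m+n ∣ I ∣ (s≤s z≤n)))
  ... | x , _ , x∉I , iIx with go k (I ∪ ⁅ x ⁆) (trans (cong (_+ k) (∣p∪⁅x⁆∣≡1+∣p∣ I x x∉I))
                                                      (trans (sym (+-suc ∣ I ∣ k)) ∣I∣+1+k≡∣J∣)) iIx
  ...   | B , Ix⊆B , iB , ∣B∣≡∣J∣ = B , (λ x∈I → Ix⊆B (p⊆p∪q ⁅ x ⁆ x∈I)) , iB , ∣B∣≡∣J∣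

-- Independence in M[E^m N^r, Q]

isNorth : Step → Bool
isNorth E = false
isNorth N = true

northSet : ∀ {k} → Vec Step k → Subset k
northSet = map isNorth

bit-isNorth : ∀ s → bit (isNorth s) ≡ isN s
bit-isNorth E = refl
bit-isNorth N = refl

nUpTo≡count-north : ∀ {k} (R : Vec Step k) t → nUpTo R t ≡ count (χ (northSet R)) t
nUpTo≡count-north []      t       = sym (count-false t (λ _ → refl))
nUpTo≡count-north (s ∷ R) zero    = refl
nUpTo≡count-north (s ∷ R) (suc t) = cong₂ _+_ (sym (bit-isNorth s)) (nUpTo≡count-north R t)

countN≡nUpTo : ∀ {k} (R : Vec Step k) → countN R ≡ nUpTo R k
countN≡nUpTo []      = refl
countN≡nUpTo (s ∷ R) = cong (isN s +_) (countN≡nUpTo R)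

χ-northSet : ∀ {k} (R : Vec Step k) x → χ (northSet R) (toℕ x) ≡ isNorth (lookup R x)
χ-northSet R x = trans (χ-toℕ (northSet R) x) (Vec.lookup-map x isNorth R)

nUpTo-monoʳ : ∀ {k} (R : Vec Step k) {t u} → t ≤ u → nUpTo R t ≤ nUpTo R u
nUpTo-monoʳ R {t} {u} t≤u =
  subst₂ _≤_ (sym (nUpTo≡count-north R t)) (sym (nUpTo≡count-north R u)) (count-monoʳ _ t≤u)

toStep : Bool → Step
toStep true  = N
toStep false = E

isNorth-toStep : ∀ b → isNorth (toStep b) ≡ b
isNorth-toStep true  = refl
isNorth-toStep false = refl

fromSubset : ∀ {k} → Subset k → Vec Step k
fromSubset = map toStep

northSet-fromSubset : ∀ {k} (B : Subset k) → northSet (fromSubset B) ≡ B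
northSet-fromSubset B = trans (sym (Vec.map-∘ isNorth toStep B)) (trans (Vec.map-cong isNorth-toStep B) (Vec.map-id B))

isE : Step → ℕ
isE E = 1
isE N = 0

eUpTo : ∀ {k} → Vec Step k → ℕ → ℕ
eUpTo []      t       = 0
eUpTo (s ∷ v) zero    = 0
eUpTo (s ∷ v) (suc t) = isE s + eUpTo v t

nUpTo+eUpTo : ∀ {k} (R : Vec Step k) t → nUpTo R t + eUpTo R t ≡ t ⊓ k
nUpTo+eUpTo []      t       = sym (⊓-zeroʳ t)
nUpTo+eUpTo (s ∷ R) zero    = refl
nUpTo+eUpTo (E ∷ R) (suc t) = trans (+-suc _ _) (cong suc (nUpTo+eUpTo R t))
nUpTo+eUpTo (N ∷ R) (suc t) = cong suc (nUpTo+eUpTo R t)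

eUpTo≤ : ∀ {k} (R : Vec Step k) t → eUpTo R t ≤ t
eUpTo≤ []      t       = z≤n
eUpTo≤ (s ∷ R) zero    = z≤n
eUpTo≤ (E ∷ R) (suc t) = s≤s (eUpTo≤ R t)
eUpTo≤ (N ∷ R) (suc t) = m≤n⇒m≤1+n (eUpTo≤ R t)

eUpTo≤eUpTo-length : ∀ {k} (R : Vec Step k) t → eUpTo R t ≤ eUpTo R k
eUpTo≤eUpTo-length []      t       = z≤n
eUpTo≤eUpTo-length (s ∷ R) zero    = z≤n
eUpTo≤eUpTo-length (s ∷ R) (suc t) = +-monoʳ-≤ (isE s) (eUpTo≤eUpTo-length R t)

eUpTo-Eᵐ : ∀ {r} m (W : Vec Step r) t → t ⊓ m ≤ eUpTo (replicate m E ++ W) t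
eUpTo-Eᵐ zero    W t       = ≤-trans (≤-reflexive (⊓-zeroʳ t)) z≤n
eUpTo-Eᵐ (suc m) W zero    = z≤n
eUpTo-Eᵐ (suc m) W (suc t) = s≤s (eUpTo-Eᵐ m W t)

-- A prefix of length t of a path to (m, r) has at most t ⊓ m east steps, and E^m N^r
-- attains this.
EmNr-notAbove : ∀ {m r} (R : Vec Step (m + r)) → IsPath m r R → NotAbove (EmNr m r) R
EmNr-notAbove {m} {r} R pathR t = +-cancelʳ-≤ (eUpTo R t) _ _ (begin
  nUpTo (EmNr m r) t + eUpTo R t
    ≤⟨ +-monoʳ-≤ _ (≤-trans (⊓-glb (eUpTo≤ R t) eUpTo≤m) (eUpTo-Eᵐ m (replicate r N) t)) ⟩
  nUpTo (EmNr m r) t + eUpTo (EmNr m r) t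
    ≡⟨ nUpTo+eUpTo (EmNr m r) t ⟩
  t ⊓ (m + r)
    ≡⟨ nUpTo+eUpTo R t ⟨
  nUpTo R t + eUpTo R t ∎)
  where
  open ≤-Reasoning
  eUpTo-total : countN R + eUpTo R (m + r) ≡ m + r
  eUpTo-total = trans (cong (_+ eUpTo R (m + r)) (countN≡nUpTo R))
                      (trans (nUpTo+eUpTo R (m + r)) (⊓-idem (m + r)))
  eUpTo≤m : eUpTo R t ≤ m
  eUpTo≤m = ≤-trans (eUpTo≤eUpTo-length R t) (≤-reflexive (+-cancelˡ-≡ r _ m
    (trans (cong (_+ eUpTo R (m + r)) (sym pathR)) (trans eUpTo-total (+-comm m r)))))

nUpTo-north-step : ∀ {k} (R : Vec Step k) x → lookup R x ≡ N → nUpTo R (toℕ x) < nUpTo R (suc (toℕ x))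
nUpTo-north-step R x Rx≡N = subst₂ _<_ (sym (nUpTo≡count-north R (toℕ x))) (sym (nUpTo≡count-north R (suc (toℕ x))))
  (count-strict (χ (northSet R)) (trans (χ-northSet R x) (cong isNorth Rx≡N)) ≤-refl)

independent⇒bounded : ∀ {m r} (Q : Vec Step (m + r)) X →
                      Indep (MPQ {m} {r} (EmNr m r) Q) X → Bounded (nUpTo Q) X
independent⇒bounded {m} {r} Q X (φ , φ-north , φ-injective) t _ = count-χ≤-injection X t f f-injective
  where
  φ<nUpTo : ∀ x x∈X → toℕ x < t → toℕ (φ x x∈X) < nUpTo Q t
  φ<nUpTo x x∈X x<t with φ-north x x∈X
  ... | R , (_ , R≤Q , _) , Rx≡N , nUpTo≡φ = begin-strict
    toℕ (φ x x∈X)          ≡⟨ nUpTo≡φ ⟨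
    nUpTo R (toℕ x)        <⟨ nUpTo-north-step R x Rx≡N ⟩
    nUpTo R (suc (toℕ x))  ≤⟨ R≤Q (suc (toℕ x)) ⟩
    nUpTo Q (suc (toℕ x))  ≤⟨ nUpTo-monoʳ Q x<t ⟩
    nUpTo Q t              ∎
    where open ≤-Reasoning
  f : ∀ x → x ∈ X → toℕ x < t → Fin (nUpTo Q t)
  f x x∈X x<t = fromℕ< (φ<nUpTo x x∈X x<t)
  f-injective : ∀ x y x∈X y∈X x<t y<t → f x x∈X x<t ≡ f y y∈X y<t → x ≡ y
  f-injective x y x∈X y∈X x<t y<t eq = φ-injective x y x∈X y∈X (Fin.toℕ-injective (Fin.fromℕ<-injective _ _ _ _ eq))

bounded⇒onPath : ∀ {m r} (Q : Vec Step (m + r)) → IsPath m r Q → ∀ X → Bounded (nUpTo Q) X →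
                 ∃ λ R → InRegion {m} {r} (EmNr m r) Q R × X ⊆ northSet R
bounded⇒onPath {m} {r} Q pathQ X bX = R , (pathR , R≤Q , EmNr-notAbove R pathR) ,
                                      subst (X ⊆_) (sym (northSet-fromSubset B)) X⊆B
  where
  northQ-bounded : Bounded (nUpTo Q) (northSet Q)
  northQ-bounded t _ = ≤-reflexive (sym (nUpTo≡count-north Q t))
  ∣X∣≤∣northQ∣ : ∣ X ∣ ≤ ∣ northSet Q ∣
  ∣X∣≤∣northQ∣ = subst₂ _≤_ (sym (∣∣≡count-χ X)) (trans (nUpTo≡count-north Q (m + r)) (sym (∣∣≡count-χ (northSet Q))))
                        (bX (m + r) ≤-refl)
  extension : ∃ λ B → X ⊆ B × Bounded (nUpTo Q) B × ∣ B ∣ ≡ ∣ northSet Q ∣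
  extension = extend-independent (boundedSystem-isMatroid (m + r) (nUpTo Q)) {X} {northSet Q}
                                 bX northQ-bounded ∣X∣≤∣northQ∣
  B : Subset (m + r)
  B = proj₁ extension
  X⊆B : X ⊆ B
  X⊆B = proj₁ (proj₂ extension)
  bB : Bounded (nUpTo Q) B
  bB = proj₁ (proj₂ (proj₂ extension))
  R : Vec Step (m + r)
  R = fromSubset B
  nUpTo-R : ∀ t → nUpTo R t ≡ count (χ B) t
  nUpTo-R t = trans (nUpTo≡count-north R t) (cong (λ V → count (χ V) t) (northSet-fromSubset B))
  pathR : IsPath m r R
  pathR = begin
    countN R                 ≡⟨ countN≡nUpTo R ⟩
    nUpTo R (m + r)          ≡⟨ nUpTo-R (m + r) ⟩
    count (χ B) (m + r)      ≡⟨ ∣∣≡count-χ B ⟨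
    ∣ B ∣                    ≡⟨ proj₂ (proj₂ (proj₂ extension)) ⟩
    ∣ northSet Q ∣           ≡⟨ ∣∣≡count-χ (northSet Q) ⟩
    count (χ (northSet Q)) (m + r) ≡⟨ nUpTo≡count-north Q (m + r) ⟨
    nUpTo Q (m + r)          ≡⟨ countN≡nUpTo Q ⟨
    countN Q                 ≡⟨ pathQ ⟩
    r                        ∎
    where open ≡-Reasoning
  R≤Q : NotAbove R Q
  R≤Q t with t ≤? m + r
  ... | yes t≤m+r = subst (_≤ nUpTo Q t) (sym (nUpTo-R t)) (bB t t≤m+r)
  ... | no  t≰m+r = subst (_≤ nUpTo Q t) (sym (trans (nUpTo-R t) (count-χ-saturates B t (≰⇒≥ t≰m+r))))
                          (≤-trans (bB (m + r) ≤-refl) (nUpTo-monoʳ Q (≰⇒≥ t≰m+r)))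

isNorth⇒≡N : ∀ {s} → isNorth s ≡ true → s ≡ N
isNorth⇒≡N {N} _ = refl

bounded⇒independent : ∀ {m r} (Q : Vec Step (m + r)) → IsPath m r Q → ∀ X →
                      Bounded (nUpTo Q) X → Indep (MPQ {m} {r} (EmNr m r) Q) X
bounded⇒independent {m} {r} Q pathQ X bX with bounded⇒onPath Q pathQ X bX
... | R , region@(pathR , _ , _) , X⊆northR = φ , φ-north , φ-injective
  where
  north : ∀ {x} → x ∈ X → χ (northSet R) (toℕ x) ≡ true
  north x∈X = ∈⇒χ (X⊆northR x∈X)
  nUpTo<r : ∀ {x} → x ∈ X → nUpTo R (toℕ x) < r
  nUpTo<r {x} x∈X = begin-strict
    nUpTo R (toℕ x)                  ≡⟨ nUpTo≡count-north R (toℕ x) ⟩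
    count (χ (northSet R)) (toℕ x)   <⟨ count-strict (χ (northSet R)) (north x∈X) (Fin.toℕ<n x) ⟩
    count (χ (northSet R)) (m + r)   ≡⟨ nUpTo≡count-north R (m + r) ⟨
    nUpTo R (m + r)                  ≡⟨ countN≡nUpTo R ⟨
    countN R                         ≡⟨ pathR ⟩
    r                                ∎
    where open ≤-Reasoning
  φ : ∀ x → x ∈ X → Fin r
  φ x x∈X = fromℕ< (nUpTo<r x∈X)
  φ-north : ∀ x (x∈X : x ∈ X) → NSet {m} {r} (EmNr m r) Q (φ x x∈X) x
  φ-north x x∈X = R , region , isNorth⇒≡N (trans (sym (χ-northSet R x)) (north x∈X)) , sym (Fin.toℕ-fromℕ< _)
  φ-injective : ∀ x y (x∈X : x ∈ X) (y∈X : y ∈ X) → φ x x∈X ≡ φ y y∈X → x ≡ y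
  φ-injective x y x∈X y∈X φx≡φy = Fin.toℕ-injective (count-injective (χ (northSet R)) (north x∈X) (north y∈X)
    (trans (sym (nUpTo≡count-north R (toℕ x)))
           (trans (Fin.fromℕ<-injective _ _ _ _ φx≡φy) (nUpTo≡count-north R (toℕ y)))))

northStep : (ℕ → ℕ) → ℕ → Bool
northStep f j = does (suc (f j) ≤? f (suc j))

pathOf : (ℕ → ℕ) → ∀ L → Vec Step L
pathOf f L = tabulate λ j → toStep (northStep f (toℕ j))

module _ (f : ℕ → ℕ) (f-zero : f 0 ≡ 0) (f-mono : ∀ s → f s ≤ f (suc s)) (f-step : ∀ s → f (suc s) ≤ suc (f s)) where

  f-suc : ∀ s → f (suc s) ≡ f s + bit (northStep f s)
  f-suc s = by-dec (suc (f s) ≤? f (suc s))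
    where
    by-dec : (up? : Dec (suc (f s) ≤ f (suc s))) → f (suc s) ≡ f s + bit (does up?)
    by-dec (yes up)   = trans (≤-antisym (f-step s) up) (+-comm 1 _)
    by-dec (no  flat) = trans (≤-antisym (≤-pred (≰⇒> flat)) (f-mono s)) (sym (+-identityʳ _))

  count-northStep : ∀ s → count (northStep f) s ≡ f s
  count-northStep zero    = sym f-zero
  count-northStep (suc s) =
    trans (count-snoc _ s) (trans (cong (_+ bit (northStep f s)) (count-northStep s)) (sym (f-suc s)))

  nUpTo-pathOf : ∀ L s → s ≤ L → nUpTo (pathOf f L) s ≡ f s
  nUpTo-pathOf L s s≤L = trans (nUpTo≡count-north (pathOf f L) s)
    (trans (count-cong s (λ p p<s → same p (<-≤-trans p<s s≤L))) (count-northStep s))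
    where
    same : ∀ p → p < L → χ (northSet (pathOf f L)) p ≡ northStep f p
    same p p<L = begin
      χ (northSet (pathOf f L)) p                            ≡⟨ χ-fromℕ< (northSet (pathOf f L)) p p<L ⟩
      lookup (northSet (pathOf f L)) (fromℕ< p<L)            ≡⟨ Vec.lookup-map (fromℕ< p<L) isNorth (pathOf f L) ⟩
      isNorth (lookup (pathOf f L) (fromℕ< p<L))             ≡⟨ cong isNorth (Vec.lookup∘tabulate _ (fromℕ< p<L)) ⟩
      isNorth (toStep (northStep f (toℕ (fromℕ< p<L))))      ≡⟨ isNorth-toStep _ ⟩
      northStep f (toℕ (fromℕ< p<L))                         ≡⟨ cong (northStep f) (Fin.toℕ-fromℕ< p<L) ⟩
      northStep f p                                          ∎
      where open ≡-Reasoning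

  pathOf-isPath : ∀ m r → f (m + r) ≡ r → IsPath m r (pathOf f (m + r))
  pathOf-isPath m r f[m+r]≡r =
    trans (countN≡nUpTo (pathOf f (m + r))) (trans (nUpTo-pathOf (m + r) (m + r) ≤-refl) f[m+r]≡r)

indep⇔bounded : ∀ {m r} (Q : Vec Step (m + r)) → IsPath m r Q → ∀ X →
                Indep (MPQ {m} {r} (EmNr m r) Q) X ⇔ Bounded (nUpTo Q) X
indep⇔bounded Q pathQ X = mk⇔ (independent⇒bounded Q X) (bounded⇒independent Q pathQ X)

MPQ-indep-∅ : ∀ {m r} (P Q : Vec Step (m + r)) → Indep (MPQ {m} {r} P Q) ⊥
MPQ-indep-∅ P Q =
  (λ _ x∈⊥ → contradiction x∈⊥ ∉⊥) , (λ _ x∈⊥ → contradiction x∈⊥ ∉⊥) , (λ _ _ x∈⊥ → contradiction x∈⊥ ∉⊥)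

-- Transporting minors along isomorphisms

lookup-ext : ∀ {A : Set} {n} {V W : Vec A n} → (∀ i → lookup V i ≡ lookup W i) → V ≡ W
lookup-ext {V = V} {W} V≗W =
  trans (sym (Vec.tabulate∘lookup V)) (trans (Vec.tabulate-cong V≗W) (Vec.tabulate∘lookup W))

lookup-embed : ∀ {n k} (τ : Fin n → Role k) X p → lookup (embed τ X) p ≡ roleMember (τ p) X
lookup-embed τ X p = Vec.lookup∘tabulate _ p

lookup-contractSet : ∀ {n k} (τ : Fin n → Role k) p → lookup (contractSet τ) p ≡ isContract (τ p)
lookup-contractSet τ p = Vec.lookup∘tabulate _ p

lookup-∪ : ∀ {n} (V W : Subset n) i → lookup (V ∪ W) i ≡ (lookup V i ∨ lookup W i)
lookup-∪ V W i = Vec.lookup-zipWith _∨_ i V W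

keep-injective : ∀ {k} {i j : Fin k} → keep i ≡ keep j → i ≡ j
keep-injective refl = refl

⊆⊥⇒≡⊥ : ∀ {n} {B : Subset n} → B ⊆ ⊥ → B ≡ ⊥
⊆⊥⇒≡⊥ B⊆⊥ = ⊆-antisym B⊆⊥ ⊥⊆

contractSet≡⊥ : ∀ {n k} (τ : Fin n → Role k) → (∀ p → isContract (τ p) ≡ false) → contractSet τ ≡ ⊥
contractSet≡⊥ τ none = lookup-ext λ p →
  trans (lookup-contractSet τ p) (trans (none p) (sym (Vec.lookup-replicate p false)))

indep⇔minorIndep-noContraction : ∀ {k} (A : IndepSystem) (τ : Fin (size A) → Role k) →
  (∀ p → isContract (τ p) ≡ false) → Indep A ⊥ → ∀ X →
  Indep A (embed τ X) ⇔ (∃ λ B → IsBasisOf A (contractSet τ) B × Indep A (embed τ X ∪ B))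
indep⇔minorIndep-noContraction A τ none A-∅ X = mk⇔
  (λ iX → ⊥ , ⊥-basis , subst (Indep A) (sym (∪-identityʳ _)) iX)
  (λ { (B , (B⊆C , _ , _) , iXB) → subst (Indep A) (trans (cong (embed τ X ∪_) (only-⊥ B⊆C)) (∪-identityʳ _)) iXB })
  where
  only-⊥ : ∀ {B} → B ⊆ contractSet τ → B ≡ ⊥
  only-⊥ {B} B⊆C = ⊆⊥⇒≡⊥ (subst (B ⊆_) (contractSet≡⊥ τ none) B⊆C)
  ⊥-basis : IsBasisOf A (contractSet τ) ⊥
  ⊥-basis = ⊥⊆ , A-∅ , λ B′ _ B′⊆C _ → only-⊥ B′⊆C

mapRole : ∀ {k l} → (Fin k → Fin l) → Role k → Role l
mapRole σ (keep q) = keep (σ q)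
mapRole σ contract = contract
mapRole σ delete   = delete

precompose : ∀ {m n} → (Fin m → Fin n) → Subset n → Subset m
precompose f Y = tabulate (lookup Y ∘ f)

lookup-precompose : ∀ {m n} (f : Fin m → Fin n) Y p → lookup (precompose f Y) p ≡ lookup Y (f p)
lookup-precompose f Y p = Vec.lookup∘tabulate (lookup Y ∘ f) p

precompose-⊆ : ∀ {m n} (f : Fin m → Fin n) {Y Y′} → Y ⊆ Y′ → precompose f Y ⊆ precompose f Y′
precompose-⊆ f {Y} {Y′} Y⊆Y′ {p} p∈ = Vec.lookup⇒[]= p _ (trans (lookup-precompose f Y′ p)
  (Vec.[]=⇒lookup (Y⊆Y′ (Vec.lookup⇒[]= (f p) Y (trans (sym (lookup-precompose f Y p)) (Vec.[]=⇒lookup p∈))))))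

precompose-∪ : ∀ {m n} (f : Fin m → Fin n) Y B → precompose f (Y ∪ B) ≡ precompose f Y ∪ precompose f B
precompose-∪ f Y B = lookup-ext λ p → trans (lookup-precompose f (Y ∪ B) p) (trans (lookup-∪ Y B (f p))
  (trans (cong₂ _∨_ (sym (lookup-precompose f Y p)) (sym (lookup-precompose f B p)))
         (sym (lookup-∪ (precompose f Y) (precompose f B) p))))

precompose-inverse : ∀ {m n} (f : Fin m → Fin n) (g : Fin n → Fin m) → (∀ p → g (f p) ≡ p) →
                     ∀ Y → precompose f (precompose g Y) ≡ Y
precompose-inverse f g g∘f Y = lookup-ext λ p →
  trans (lookup-precompose f (precompose g Y) p) (trans (lookup-precompose g Y (f p)) (cong (lookup Y) (g∘f p)))

module IsoRelabelling {M A : IndepSystem} (iso : Iso M A) (A-∅ : Indep A ⊥) where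
  open Minor (proj₁ iso)

  σ : Fin (size A) → Fin (size M)
  σ p = proj₁ (proj₂ iso p)

  τ≡keep-σ : ∀ p → τ p ≡ keep (σ p)
  τ≡keep-σ p = proj₂ (proj₂ iso p)

  σ⁻¹ : Fin (size M) → Fin (size A)
  σ⁻¹ i = proj₁ (surj i)

  σ∘σ⁻¹ : ∀ i → σ (σ⁻¹ i) ≡ i
  σ∘σ⁻¹ i = keep-injective (trans (sym (τ≡keep-σ (σ⁻¹ i))) (proj₂ (surj i)))

  σ-injective : ∀ {p p′} → σ p ≡ σ p′ → p ≡ p′
  σ-injective {p} {p′} σp≡σp′ = inj (τ≡keep-σ p) (trans (τ≡keep-σ p′) (cong keep (sym σp≡σp′)))

  relabel : Subset (size M) → Subset (size A)
  relabel = precompose σ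

  unrelabel : Subset (size A) → Subset (size M)
  unrelabel = precompose σ⁻¹

  embed≡relabel : ∀ Y → embed τ Y ≡ relabel Y
  embed≡relabel Y = lookup-ext λ p →
    trans (lookup-embed τ Y p) (trans (cong (λ ρ → roleMember ρ Y) (τ≡keep-σ p)) (sym (lookup-precompose σ Y p)))

  unrelabel-relabel : ∀ Y → unrelabel (relabel Y) ≡ Y
  unrelabel-relabel = precompose-inverse σ⁻¹ σ σ∘σ⁻¹

  relabel-unrelabel : ∀ Z → relabel (unrelabel Z) ≡ Z
  relabel-unrelabel = precompose-inverse σ σ⁻¹ (λ p → σ-injective (σ∘σ⁻¹ (σ p)))

  relabel-∪ : ∀ Y B → relabel (Y ∪ B) ≡ relabel Y ∪ relabel B
  relabel-∪ = precompose-∪ σ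

  relabel-⊆ : ∀ {Y Y′} → Y ⊆ Y′ → relabel Y ⊆ relabel Y′
  relabel-⊆ = precompose-⊆ σ

  relabel-⊆⁻ : ∀ {Y Y′} → relabel Y ⊆ relabel Y′ → Y ⊆ Y′
  relabel-⊆⁻ {Y} {Y′} rY⊆rY′ = subst₂ _⊆_ (unrelabel-relabel Y) (unrelabel-relabel Y′) (precompose-⊆ σ⁻¹ rY⊆rY′)

  indep-relabel : ∀ Y → Indep M Y ⇔ Indep A (relabel Y)
  indep-relabel Y = subst (λ Z → Indep M Y ⇔ Indep A Z) (embed≡relabel Y)
    (mk⇔ (from (noContraction Y) ∘ to (indep Y)) (from (indep Y) ∘ to (noContraction Y)))
    where
    noContraction : ∀ Y → Indep A (embed τ Y) ⇔ (∃ λ B → IsBasisOf A (contractSet τ) B × Indep A (embed τ Y ∪ B))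
    noContraction = indep⇔minorIndep-noContraction A τ (λ p → cong isContract (τ≡keep-σ p)) A-∅

  relabel-basis : ∀ {C B} → IsBasisOf M C B → IsBasisOf A (relabel C) (relabel B)
  relabel-basis {C} {B} (B⊆C , iB , maximal) = relabel-⊆ B⊆C , to (indep-relabel B) iB , λ Z rB⊆Z Z⊆rC iZ →
    trans (Z≡rZ′ Z) (cong relabel (maximal (unrelabel Z) (relabel-⊆⁻ (subst (relabel B ⊆_) (Z≡rZ′ Z) rB⊆Z))
                                                        (relabel-⊆⁻ (subst (_⊆ relabel C) (Z≡rZ′ Z) Z⊆rC))
                                                        (from (indep-relabel _) (subst (Indep A) (Z≡rZ′ Z) iZ))))
    where
    Z≡rZ′ : ∀ Z → Z ≡ relabel (unrelabel Z)
    Z≡rZ′ Z = sym (relabel-unrelabel Z)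

  unrelabel-basis : ∀ {C Z} → IsBasisOf A (relabel C) Z → IsBasisOf M C (unrelabel Z)
  unrelabel-basis {C} {Z} (Z⊆rC , iZ , maximal) =
    relabel-⊆⁻ (subst (_⊆ relabel C) Z≡rZ′ Z⊆rC) , from (indep-relabel _) (subst (Indep A) Z≡rZ′ iZ) ,
    λ B′ Z′⊆B′ B′⊆C iB′ → trans (sym (unrelabel-relabel B′))
      (cong unrelabel (maximal (relabel B′) (subst (_⊆ relabel B′) (relabel-unrelabel Z) (relabel-⊆ Z′⊆B′))
                                            (relabel-⊆ B′⊆C) (to (indep-relabel B′) iB′)))
    where
    Z≡rZ′ : Z ≡ relabel (unrelabel Z)
    Z≡rZ′ = sym (relabel-unrelabel Z)

Minor-respʳ-Iso : ∀ {M′ M A} → Iso M A → Indep A ⊥ → Minor M′ M → Minor M′ A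
Minor-respʳ-Iso {M′} {M} {A} iso A-∅ ν = record
  { τ = τ′ ; surj = surj′ ; inj = inj′ ; indep = indep′ }
  where
  open IsoRelabelling iso A-∅
  module ν = Minor ν
  τ′ : Fin (size A) → Role (size M′)
  τ′ = ν.τ ∘ σ
  surj′ : ∀ i → ∃ λ p → τ′ p ≡ keep i
  surj′ i = σ⁻¹ (proj₁ (ν.surj i)) , trans (cong ν.τ (σ∘σ⁻¹ _)) (proj₂ (ν.surj i))
  inj′ : ∀ {i p p′} → τ′ p ≡ keep i → τ′ p′ ≡ keep i → p ≡ p′
  inj′ τ′p τ′p′ = σ-injective (ν.inj τ′p τ′p′)
  contractSet-τ′ : contractSet τ′ ≡ relabel (contractSet ν.τ)
  contractSet-τ′ = lookup-ext λ p →
    trans (lookup-contractSet τ′ p)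
          (trans (sym (lookup-contractSet ν.τ (σ p))) (sym (lookup-precompose σ (contractSet ν.τ) p)))
  embed-τ′ : ∀ X → embed τ′ X ≡ relabel (embed ν.τ X)
  embed-τ′ X = lookup-ext λ p →
    trans (lookup-embed τ′ X p) (trans (sym (lookup-embed ν.τ X (σ p))) (sym (lookup-precompose σ (embed ν.τ X) p)))
  indep′ : ∀ X → Indep M′ X ⇔ (∃ λ B → IsBasisOf A (contractSet τ′) B × Indep A (embed τ′ X ∪ B))
  indep′ X = mk⇔ forward backward
    where
    Y : Subset (size M)
    Y = embed ν.τ X
    forward : Indep M′ X → ∃ λ B → IsBasisOf A (contractSet τ′) B × Indep A (embed τ′ X ∪ B)
    forward iX with to (ν.indep X) iX
    ... | B , basis , iYB =
      relabel B , subst (λ C → IsBasisOf A C (relabel B)) (sym contractSet-τ′) (relabel-basis basis) ,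
      subst (λ Z → Indep A (Z ∪ relabel B)) (sym (embed-τ′ X))
            (subst (Indep A) (relabel-∪ Y B) (to (indep-relabel _) iYB))
    backward : (∃ λ B → IsBasisOf A (contractSet τ′) B × Indep A (embed τ′ X ∪ B)) → Indep M′ X
    backward (Z , basis , iXZ) = from (ν.indep X)
      (unrelabel Z , unrelabel-basis (subst (λ C → IsBasisOf A C Z) contractSet-τ′ basis) ,
       from (indep-relabel _) (subst (Indep A) (sym (trans (relabel-∪ Y (unrelabel Z))
                                                   (cong₂ _∪_ (sym (embed-τ′ X)) (relabel-unrelabel Z)))) iXZ))

Minor-respˡ-Iso : ∀ {M A K} → Iso M A → Indep A ⊥ → Minor A K → Minor M K
Minor-respˡ-Iso {M} {A} {K} iso A-∅ κ = record
  { τ = τ′ ; surj = surj′ ; inj = inj′ ; indep = indep′ }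
  where
  open IsoRelabelling iso A-∅
  module κ = Minor κ
  τ′ : Fin (size K) → Role (size M)
  τ′ = mapRole σ ∘ κ.τ
  surj′ : ∀ i → ∃ λ p → τ′ p ≡ keep i
  surj′ i = proj₁ (κ.surj (σ⁻¹ i)) , trans (cong (mapRole σ) (proj₂ (κ.surj (σ⁻¹ i)))) (cong keep (σ∘σ⁻¹ i))
  kept : ∀ {i} ρ → mapRole σ ρ ≡ keep i → ρ ≡ keep (σ⁻¹ i)
  kept (keep q) σq≡i = cong keep (σ-injective (trans (keep-injective σq≡i) (sym (σ∘σ⁻¹ _))))
  inj′ : ∀ {i p p′} → τ′ p ≡ keep i → τ′ p′ ≡ keep i → p ≡ p′
  inj′ {p = p} {p′} τ′p τ′p′ = κ.inj (kept (κ.τ p) τ′p) (kept (κ.τ p′) τ′p′)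
  isContract-mapRole : ∀ ρ → isContract (mapRole σ ρ) ≡ isContract ρ
  isContract-mapRole (keep _) = refl
  isContract-mapRole contract = refl
  isContract-mapRole delete   = refl
  roleMember-mapRole : ∀ ρ X → roleMember (mapRole σ ρ) X ≡ roleMember ρ (relabel X)
  roleMember-mapRole (keep q) X = sym (lookup-precompose σ X q)
  roleMember-mapRole contract X = refl
  roleMember-mapRole delete   X = refl
  contractSet-τ′ : contractSet τ′ ≡ contractSet κ.τ
  contractSet-τ′ = lookup-ext λ p →
    trans (lookup-contractSet τ′ p) (trans (isContract-mapRole (κ.τ p)) (sym (lookup-contractSet κ.τ p)))
  embed-τ′ : ∀ X → embed τ′ X ≡ embed κ.τ (relabel X)
  embed-τ′ X = lookup-ext λ p →
    trans (lookup-embed τ′ X p) (trans (roleMember-mapRole (κ.τ p) X) (sym (lookup-embed κ.τ _ p)))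
  transport : ∀ X → (∃ λ B → IsBasisOf K (contractSet κ.τ) B × Indep K (embed κ.τ (relabel X) ∪ B)) ≡
                    (∃ λ B → IsBasisOf K (contractSet τ′) B × Indep K (embed τ′ X ∪ B))
  transport X = cong₂ (λ C Y → ∃ λ B → IsBasisOf K C B × Indep K (Y ∪ B)) (sym contractSet-τ′) (sym (embed-τ′ X))
  indep′ : ∀ X → Indep M X ⇔ (∃ λ B → IsBasisOf K (contractSet τ′) B × Indep K (embed τ′ X ∪ B))
  indep′ X = mk⇔ (subst id (transport X) ∘ to (κ.indep _) ∘ to (indep-relabel X))
                 (from (indep-relabel X) ∘ from (κ.indep _) ∘ subst id (sym (transport X)))

module _ {n : ℕ} {I J : Subset n → Set} (I⇔J : ∀ X → I X ⇔ J X) where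

  private
    S T : IndepSystem
    S = record { size = n ; Indep = I }
    T = record { size = n ; Indep = J }

    basis-transport : ∀ {C B} → IsBasisOf S C B → IsBasisOf T C B
    basis-transport (B⊆C , iB , maximal) =
      B⊆C , to (I⇔J _) iB , λ B′ B⊆B′ B′⊆C iB′ → maximal B′ B⊆B′ B′⊆C (from (I⇔J _) iB′)

    basis-transport⁻ : ∀ {C B} → IsBasisOf T C B → IsBasisOf S C B
    basis-transport⁻ (B⊆C , iB , maximal) =
      B⊆C , from (I⇔J _) iB , λ B′ B⊆B′ B′⊆C iB′ → maximal B′ B⊆B′ B′⊆C (to (I⇔J _) iB′)

  Minor-resp-⇔ : ∀ {M′} → Minor M′ S → Minor M′ T
  Minor-resp-⇔ μ = record
    { τ = τ ; surj = surj ; inj = inj ; indep = λ X → mk⇔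
      (map₂ (map-× basis-transport (to (I⇔J _))) ∘ to (indep X))
      (from (indep X) ∘ map₂ (map-× basis-transport⁻ (from (I⇔J _)))) }
    where open Minor μ

  IsMatroid-resp-⇔ : IsMatroid S → IsMatroid T
  IsMatroid-resp-⇔ isM = record
    { indep-∅ = to (I⇔J _) indep-∅
    ; indep-⊆ = λ I⊆J iJ → to (I⇔J _) (indep-⊆ I⊆J (from (I⇔J _) iJ))
    ; augment = λ iI iJ ∣I∣<∣J∣ → map₂ (map₂ (map₂ (to (I⇔J _)))) (augment (from (I⇔J _) iI) (from (I⇔J _) iJ) ∣I∣<∣J∣)
    }
    where open IsMatroid isM

Iso-refl : ∀ A → Indep A ⊥ → Iso A A
Iso-refl A A-∅ = record { τ = keep ; surj = λ i → i , refl ; inj = λ { refl refl → refl } ; indep = indep′ } ,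
                 λ p → p , refl
  where
  embed-keep : ∀ X → embed keep X ≡ X
  embed-keep X = lookup-ext (lookup-embed keep X)
  indep′ : ∀ X → Indep A X ⇔ (∃ λ B → IsBasisOf A (contractSet keep) B × Indep A (embed keep X ∪ B))
  indep′ X = subst (λ Y → Indep A Y ⇔ (∃ λ B → IsBasisOf A (contractSet keep) B × Indep A (embed keep X ∪ B)))
                   (embed-keep X) (indep⇔minorIndep-noContraction A keep (λ _ → refl) A-∅ X)

-- Contraction in a prefix-bounded system

Bounded-fromFin : ∀ {n} c (X : Subset n) → (∀ (i : Fin (suc n)) → count (χ X) (toℕ i) ≤ c (toℕ i)) → Bounded c X
Bounded-fromFin c X bX t t≤n = subst (λ s → count (χ X) s ≤ c s) (Fin.toℕ-fromℕ< (s≤s t≤n)) (bX (fromℕ< (s≤s t≤n)))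

bounded? : ∀ {n} c (X : Subset n) → Dec (Bounded c X)
bounded? {n} c X = map′ (Bounded-fromFin c X) (λ bX i → bX (toℕ i) (≤-pred (Fin.toℕ<n i)))
                        (Fin.all? λ (i : Fin (suc n)) → count (χ X) (toℕ i) ≤? c (toℕ i))

violation : ∀ {n} c (X : Subset n) → ¬ Bounded c X → ∃ λ t → t ≤ n × c t < count (χ X) t
violation {n} c X ¬bX with Fin.¬∀⟶∃¬ (suc n) _ (λ i → count (χ X) (toℕ i) ≤? c (toℕ i)) (¬bX ∘ Bounded-fromFin c X)
... | i , ¬i = toℕ i , ≤-pred (Fin.toℕ<n i) , ≰⇒> ¬i

shift : (ℕ → ℕ) → ℕ → ℕ
shift c t = c (suc t)

greedy : ∀ {n} → (ℕ → ℕ) → Subset n → Subset n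
greedy c []      = []
greedy c (b ∷ C) = (b ∧ does (bounded? c (true ∷ greedy (shift c) C))) ∷ greedy (shift c) C

greedy⊆ : ∀ {n} c (C : Subset n) → greedy c C ⊆ C
greedy⊆ c (b ∷ C) = χ⇒⊆ go
  where
  go : ∀ p → χ (greedy c (b ∷ C)) p ≡ true → χ (b ∷ C) p ≡ true
  go zero    head = ∧-true-l head
    where
    ∧-true-l : ∀ {a d} → (a ∧ d) ≡ true → a ≡ true
    ∧-true-l {true} _ = refl
  go (suc p) tail = ⊆⇒χ (greedy⊆ (shift c) C) p tail

greedy-bounded : ∀ {n} c (C : Subset n) → Bounded c (greedy c C)
greedy-bounded c []      t _ = subst (_≤ c t) (sym (count-false t (λ _ → refl))) z≤n
greedy-bounded c (b ∷ C) = by-head b (bounded? c (true ∷ S))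
  where
  S : Subset _
  S = greedy (shift c) C
  head-dropped : Bounded c (false ∷ S)
  head-dropped zero    _         = z≤n
  head-dropped (suc t) (s≤s t≤n) = greedy-bounded (shift c) C t t≤n
  by-head : ∀ b (d : Dec (Bounded c (true ∷ S))) → Bounded c ((b ∧ does d) ∷ S)
  by-head true  (yes bounded) = bounded
  by-head true  (no _)        = head-dropped
  by-head false _             = head-dropped

Bounded-tail : ∀ {n} c b (B : Subset n) → Bounded c (b ∷ B) → Bounded (shift c) B
Bounded-tail c b B bB t t≤n = ≤-trans (m≤n+m _ (bit b)) (bB (suc t) (s≤s t≤n))

greedy-dominates : ∀ {n} c (C B : Subset n) → B ⊆ C → Bounded c B → ∀ u →
                   count (χ B) n + count (χ (greedy c C)) u ≤ count (χ (greedy c C)) n + count (χ B) u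
greedy-dominates c []      []        _   _  u = ≤-refl
greedy-dominates {suc n} c (b ∷ C) (b′ ∷ B) B⊆C bB = dominates
  where
  S : Subset n
  S = greedy (shift c) C
  IH : ∀ u → count (χ B) n + count (χ S) u ≤ count (χ S) n + count (χ B) u
  IH = greedy-dominates (shift c) C B (drop-∷-⊆ B⊆C) (Bounded-tail c b′ B bB)
  IH₀ : count (χ B) n ≤ count (χ S) n
  IH₀ = subst₂ _≤_ (+-identityʳ _) (+-identityʳ _) (IH 0)
  head : ∀ b (d : Dec (Bounded c (true ∷ S))) b′ → (b′ ≡ true → b ≡ true) → Bounded c (b′ ∷ B) →
         bit b′ + count (χ B) n ≤ bit (b ∧ does d) + count (χ S) n
  head _     _             false _      _  = ≤-trans IH₀ (m≤n+m _ _)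
  head true  (yes _)       true  _      _  = s≤s IH₀
  head false _             true  b′⇒b   _  = contradiction (b′⇒b refl) λ ()
  head true  (no ¬bounded) true  _      bB with violation c (true ∷ S) ¬bounded
  ... | suc t , s≤s t≤n , c<count = +-cancelʳ-≤ (count (χ B) t) _ _ (begin
    suc (count (χ B) n) + count (χ B) t ≡⟨ +-suc (count (χ B) n) _ ⟨
    count (χ B) n + suc (count (χ B) t) ≤⟨ +-monoʳ-≤ (count (χ B) n) (≤-trans (bB (suc t) (s≤s t≤n)) (≤-pred c<count)) ⟩
    count (χ B) n + count (χ S) t       ≤⟨ IH t ⟩
    count (χ S) n + count (χ B) t       ∎)
    where open ≤-Reasoning
  dominates : ∀ u → bit b′ + count (χ B) n + count (χ (greedy c (b ∷ C))) u ≤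
                    bit (b ∧ does (bounded? c (true ∷ S))) + count (χ S) n + count (χ (b′ ∷ B)) u
  dominates zero    = subst₂ _≤_ (sym (+-identityʳ _)) (sym (+-identityʳ _))
                             (head b (bounded? c (true ∷ S)) b′ (⊆⇒χ B⊆C 0) bB)
  dominates (suc u) = subst₂ _≤_ (sym (interchange (bit b′) (count (χ B) n) (bit h) (count (χ S) u)))
                                 (sym (interchange (bit h) (count (χ S) n) (bit b′) (count (χ B) u)))
                                 (+-mono-≤ (≤-reflexive (+-comm (bit b′) (bit h))) (IH u))
    where
    h : Bool
    h = b ∧ does (bounded? c (true ∷ S))

⊆∧∣∣≥⇒≡ : ∀ {n} {V W : Subset n} → V ⊆ W → ∣ W ∣ ≤ ∣ V ∣ → V ≡ W
⊆∧∣∣≥⇒≡ {V = []}        {[]}        _   _ = refl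
⊆∧∣∣≥⇒≡ {V = true ∷ V}  {true ∷ W}  V⊆W ∣W∣≤∣V∣ = cong (true ∷_) (⊆∧∣∣≥⇒≡ (drop-∷-⊆ V⊆W) (≤-pred ∣W∣≤∣V∣))
⊆∧∣∣≥⇒≡ {V = true ∷ V}  {false ∷ W} V⊆W _ with V⊆W here
... | ()
⊆∧∣∣≥⇒≡ {V = false ∷ V} {true ∷ W}  V⊆W ∣W∣≤∣V∣ =
  contradiction (≤-trans ∣W∣≤∣V∣ (p⊆q⇒∣p∣≤∣q∣ (drop-∷-⊆ V⊆W))) (<-irrefl refl)
⊆∧∣∣≥⇒≡ {V = false ∷ V} {false ∷ W} V⊆W ∣W∣≤∣V∣ = cong (false ∷_) (⊆∧∣∣≥⇒≡ (drop-∷-⊆ V⊆W) ∣W∣≤∣V∣)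

module _ {n : ℕ} (c : ℕ → ℕ) (C : Subset n) where

  private
    G : Subset n
    G = greedy c C

  greedy-isBasis : IsBasisOf (boundedSystem n c) C G
  greedy-isBasis = greedy⊆ c C , greedy-bounded c C , maximal
    where
    maximal : ∀ B → G ⊆ B → B ⊆ C → Bounded c B → B ≡ G
    maximal B G⊆B B⊆C bB = sym (⊆∧∣∣≥⇒≡ G⊆B (subst₂ _≤_ (sym (∣∣≡count-χ B)) (sym (∣∣≡count-χ G))
      (subst₂ _≤_ (+-identityʳ _) (+-identityʳ _) (greedy-dominates c C B B⊆C bB 0))))

  greedy-count-minimal : ∀ B → IsBasisOf (boundedSystem n c) C B → ∀ t → count (χ G) t ≤ count (χ B) t
  greedy-count-minimal B (B⊆C , bB , maximal) t = +-cancelˡ-≤ (count (χ B) n) _ _ (begin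
    count (χ B) n + count (χ G) t ≤⟨ greedy-dominates c C B B⊆C bB t ⟩
    count (χ G) n + count (χ B) t ≤⟨ +-monoˡ-≤ _ (subst₂ _≤_ (∣∣≡count-χ G) (∣∣≡count-χ B) ∣G∣≤∣B∣) ⟩
    count (χ B) n + count (χ B) t ∎)
    where
    open ≤-Reasoning
    ∣G∣≤∣B∣ : ∣ G ∣ ≤ ∣ B ∣
    ∣G∣≤∣B∣ with ∣ B ∣ <? ∣ G ∣
    ... | no  ∣B∣≮∣G∣ = ≮⇒≥ ∣B∣≮∣G∣
    ... | yes ∣B∣<∣G∣ with augment-bounded c bB (greedy-bounded c C) ∣B∣<∣G∣
    ...   | x , x∈G , x∉B , bBx = contradiction (subst (x ∈_) Bx≡B (q⊆p∪q B ⁅ x ⁆ (x∈⁅x⁆ x))) x∉B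
      where
      Bx⊆C : B ∪ ⁅ x ⁆ ⊆ C
      Bx⊆C y∈Bx with x∈p∪q⁻ B ⁅ x ⁆ y∈Bx
      ... | inj₁ y∈B = B⊆C y∈B
      ... | inj₂ y∈x = subst (_∈ C) (sym (x∈⁅y⁆⇒x≡y x y∈x)) (greedy⊆ c C x∈G)
      Bx≡B : B ∪ ⁅ x ⁆ ≡ B
      Bx≡B = maximal (B ∪ ⁅ x ⁆) (p⊆p∪q ⁅ x ⁆) Bx⊆C bBx

contractBound : ∀ {n} → (ℕ → ℕ) → Subset n → ℕ → ℕ
contractBound c C t = c t ∸ count (χ (greedy c C)) t

member⇒notContracted : ∀ {k} (ρ : Role k) X → roleMember ρ X ≡ true → isContract ρ ≡ false
member⇒notContracted (keep _) _ _ = refl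

minor-of-bounded : ∀ {M′ n} c (μ : Minor M′ (boundedSystem n c)) X →
                   Indep M′ X ⇔ Bounded (contractBound c (contractSet (Minor.τ μ))) (embed (Minor.τ μ) X)
minor-of-bounded {M′} {n} c μ X = mk⇔ bounded bounded⁻
  where
  open Minor μ
  C G Y : Subset n
  C = contractSet τ
  G = greedy c C
  Y = embed τ X
  Y∩C=∅ : ∀ p → χ Y p ≡ true → χ C p ≡ false
  Y∩C=∅ p χYp with χ-element Y p χYp
  ... | x , refl , x∈Y = trans (χ-toℕ C x) (trans (lookup-contractSet τ x)
    (member⇒notContracted (τ x) X (trans (sym (lookup-embed τ X x)) (Vec.[]=⇒lookup x∈Y))))
  count-Y∪ : ∀ V → V ⊆ C → ∀ t → count (χ (Y ∪ V)) t ≡ count (χ Y) t + count (χ V) t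
  count-Y∪ V V⊆C t = trans (count-cong t (λ p _ → χ-∪ Y V p)) (count-∨-disjoint (χ Y) (χ V) t Y∩V=∅)
    where
    Y∩V=∅ : ∀ p → χ Y p ≡ true → χ V p ≡ false
    Y∩V=∅ p χYp with χ V p in χVp
    ... | false = refl
    ... | true  = contradiction (trans (sym (⊆⇒χ V⊆C p χVp)) (Y∩C=∅ p χYp)) λ ()
  bounded : Indep M′ X → Bounded (contractBound c C) Y
  bounded iX t t≤n with to (indep X) iX
  ... | B , basis@(B⊆C , _ , _) , bYB = m+n≤o⇒m≤o∸n (count (χ Y) t) (begin
    count (χ Y) t + count (χ G) t ≤⟨ +-monoʳ-≤ (count (χ Y) t) (greedy-count-minimal c C B basis t) ⟩
    count (χ Y) t + count (χ B) t ≡⟨ count-Y∪ B B⊆C t ⟨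
    count (χ (Y ∪ B)) t           ≤⟨ bYB t t≤n ⟩
    c t                           ∎)
    where open ≤-Reasoning
  bounded⁻ : Bounded (contractBound c C) Y → Indep M′ X
  bounded⁻ bY = from (indep X) (G , greedy-isBasis c C , λ t t≤n →
    subst (_≤ c t) (sym (count-Y∪ G (greedy⊆ c C) t)) (m≤o∸n⇒m+n≤o _ (greedy-bounded c C t t≤n) (bY t t≤n)))

-- Renumbering the elements of a minor

minUpTo : (ℕ → ℕ) → ℕ → ℕ
minUpTo f zero    = f 0
minUpTo f (suc n) = minUpTo f n ⊓ f (suc n)

minUpTo≤ : ∀ f {n t} → t ≤ n → minUpTo f n ≤ f t
minUpTo≤ f {zero}  z≤n = ≤-refl
minUpTo≤ f {suc n} t≤1+n with m≤n⇒m<n∨m≡n t≤1+n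
... | inj₁ t<1+n = ≤-trans (m⊓n≤m _ _) (minUpTo≤ f (≤-pred t<1+n))
... | inj₂ refl  = m⊓n≤n _ _

minUpTo-greatest : ∀ f n {v} → (∀ t → t ≤ n → v ≤ f t) → v ≤ minUpTo f n
minUpTo-greatest f zero    v≤f = v≤f 0 z≤n
minUpTo-greatest f (suc n) v≤f = ⊓-glb (minUpTo-greatest f n (λ t t≤n → v≤f t (m≤n⇒m≤1+n t≤n))) (v≤f (suc n) ≤-refl)

minUpTo-mono : ∀ f g n → (∀ t → f t ≤ g t) → minUpTo f n ≤ minUpTo g n
minUpTo-mono f g n f≤g = minUpTo-greatest g n (λ t t≤n → ≤-trans (minUpTo≤ f t≤n) (f≤g t))

minUpTo-≤suc : ∀ f g n → (∀ t → f t ≤ suc (g t)) → minUpTo f n ≤ suc (minUpTo g n)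
minUpTo-≤suc f g zero    f≤1+g = f≤1+g 0
minUpTo-≤suc f g (suc n) f≤1+g = ⊓-mono-≤ (minUpTo-≤suc f g n f≤1+g) (f≤1+g (suc n))

suc∸≤suc[∸] : ∀ s a → suc s ∸ a ≤ suc (s ∸ a)
suc∸≤suc[∸] s       zero    = ≤-refl
suc∸≤suc[∸] zero    (suc a) = subst (_≤ 1) (sym (0∸n≡0 a)) z≤n
suc∸≤suc[∸] (suc s) (suc a) = suc∸≤suc[∸] s a

-- A set with count ≤ d t on the prefix of length ρ t has count ≤ d t + (s ∸ ρ t) on the
-- prefix of length s ≥ ρ t; hull is the best bound of this kind. Unlike d it grows in
-- unit steps, so it is the north count of a lattice path.
module _ (d ρ : ℕ → ℕ) (n : ℕ) where

  hull : ℕ → ℕ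
  hull s = s ⊓ minUpTo (λ t → d t + (s ∸ ρ t)) n

  hull≤ : ∀ s → hull s ≤ s
  hull≤ s = m⊓n≤m _ _

  hull-mono : ∀ s → hull s ≤ hull (suc s)
  hull-mono s = ⊓-mono-≤ (n≤1+n s) (minUpTo-mono _ _ n (λ t → +-monoʳ-≤ (d t) (∸-monoˡ-≤ (ρ t) (n≤1+n s))))

  hull-step : ∀ s → hull (suc s) ≤ suc (hull s)
  hull-step s = ⊓-mono-≤ ≤-refl (minUpTo-≤suc _ _ n (λ t →
    ≤-trans (+-monoʳ-≤ (d t) (suc∸≤suc[∸] s (ρ t))) (≤-reflexive (+-suc (d t) _))))

isKeep : ∀ {k} → Role k → Bool
isKeep (keep _) = true
isKeep contract = false
isKeep delete   = false

keepOf : ∀ {k} (ρ : Role k) → isKeep ρ ≡ true → ∃ λ i → ρ ≡ keep i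
keepOf (keep i) _ = i , refl

module Compression {M′ A : IndepSystem} (μ : Minor M′ A) (d : ℕ → ℕ)
                   (indep⇔ : ∀ X → Indep M′ X ⇔ Bounded {size A} d (embed (Minor.τ μ) X)) where
  open Minor μ

  n : ℕ
  n = size A

  K : Subset n
  K = tabulate (isKeep ∘ τ)

  rank : ℕ → ℕ
  rank = count (χ K)

  κ : ℕ
  κ = rank n

  χ-K : ∀ t (t<n : t < n) → χ K t ≡ isKeep (τ (fromℕ< t<n))
  χ-K t t<n = trans (χ-fromℕ< K t t<n) (Vec.lookup∘tabulate _ (fromℕ< t<n))

  χ-K-toℕ : ∀ x → χ K (toℕ x) ≡ isKeep (τ x)
  χ-K-toℕ x = trans (χ-toℕ K x) (Vec.lookup∘tabulate _ x)

  record Ranked (q : ℕ) : Set where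
    field
      pos      : Fin n
      label    : Fin (size M′)
      τ-pos    : τ pos ≡ keep label
      rank-pos : rank (toℕ pos) ≡ q

  ranked : ∀ q → q < κ → Ranked q
  ranked q q<κ with count-attains (χ K) n q q<κ
  ... | p , p<n , χKp , rank≡q with keepOf (τ (fromℕ< p<n)) (trans (sym (χ-K p p<n)) χKp)
  ...   | i , τp≡i = record { pos = fromℕ< p<n ; label = i ; τ-pos = τp≡i
                            ; rank-pos = trans (cong rank (Fin.toℕ-fromℕ< p<n)) rank≡q }

  Ranked-kept : ∀ {q} (R : Ranked q) → χ K (toℕ (Ranked.pos R)) ≡ true
  Ranked-kept R = trans (χ-K-toℕ (Ranked.pos R)) (cong isKeep (Ranked.τ-pos R))

  ranked-unique : ∀ {q q′} → q ≡ q′ → (R : Ranked q) (R′ : Ranked q′) → Ranked.label R ≡ Ranked.label R′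
  ranked-unique q≡q′ R R′ = keep-injective (trans (sym (τ-pos R)) (trans (cong τ same-pos) (τ-pos R′)))
    where
    open Ranked
    same-pos : pos R ≡ pos R′
    same-pos = Fin.toℕ-injective
      (count-injective (χ K) (Ranked-kept R) (Ranked-kept R′) (trans (rank-pos R) (trans q≡q′ (sym (rank-pos R′)))))

  e : ℕ → ℕ
  e = hull d rank n

  r m : ℕ
  r = e κ
  m = κ ∸ r

  m+r≡κ : m + r ≡ κ
  m+r≡κ = m∸n+n≡m (hull≤ d rank n κ)

  Ranked-bound : ∀ {q} → Ranked q → q < m + r
  Ranked-bound R = subst₂ _<_ (Ranked.rank-pos R) (sym m+r≡κ) (count-strict (χ K) (Ranked-kept R) (Fin.toℕ<n (Ranked.pos R)))

  Q : Vec Step (m + r)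
  Q = pathOf e (m + r)

  pathQ : IsPath m r Q
  pathQ = pathOf-isPath e refl (hull-mono d rank n) (hull-step d rank n) m r (cong e m+r≡κ)

  label : Fin (m + r) → Fin (size M′)
  label q = Ranked.label (ranked (toℕ q) (subst (toℕ q <_) m+r≡κ (Fin.toℕ<n q)))

  compress : Subset (size M′) → Subset (m + r)
  compress = embed (keep ∘ label)

  χ-compress : ∀ X q → q < m + r → (R : Ranked q) → χ (compress X) q ≡ lookup X (Ranked.label R)
  χ-compress X q q<m+r R = begin
    χ (compress X) q
      ≡⟨ χ-fromℕ< (compress X) q q<m+r ⟩
    lookup (compress X) (fromℕ< q<m+r)
      ≡⟨ lookup-embed (keep ∘ label) X (fromℕ< q<m+r) ⟩
    lookup X (label (fromℕ< q<m+r))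
      ≡⟨ cong (lookup X) (ranked-unique (Fin.toℕ-fromℕ< q<m+r) (ranked _ _) R) ⟩
    lookup X (Ranked.label R) ∎
    where open ≡-Reasoning

  rank-suc : ∀ t (t<n : t < n) → rank (suc t) ≡ rank t + bit (isKeep (τ (fromℕ< t<n)))
  rank-suc t t<n = trans (count-snoc (χ K) t) (cong (λ b → rank t + bit b) (χ-K t t<n))

  rank≤κ : ∀ {t} → t ≤ n → rank t ≤ κ
  rank≤κ = count-monoʳ (χ K)

  count-compress : ∀ X t → t ≤ n → count (χ (embed τ X)) t ≡ count (χ (compress X)) (rank t)
  count-compress X zero    _   = refl
  count-compress X (suc t) t<n = begin
    count (χ (embed τ X)) (suc t)
      ≡⟨ count-snoc _ t ⟩
    count (χ (embed τ X)) t + bit (χ (embed τ X) t)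
      ≡⟨ cong₂ (λ c b → c + bit b) (count-compress X t (<⇒≤ t<n)) χ-embed ⟩
    count (χ (compress X)) (rank t) + bit (roleMember (τ x) X)
      ≡⟨ step (τ x) refl ⟨
    count (χ (compress X)) (rank t + bit (isKeep (τ x)))
      ≡⟨ cong (count (χ (compress X))) (rank-suc t t<n) ⟨
    count (χ (compress X)) (rank (suc t)) ∎
    where
    open ≡-Reasoning
    x : Fin n
    x = fromℕ< t<n
    χ-embed : χ (embed τ X) t ≡ roleMember (τ x) X
    χ-embed = trans (χ-fromℕ< (embed τ X) t t<n) (lookup-embed τ X x)
    unchanged : count (χ (compress X)) (rank t + 0) ≡ count (χ (compress X)) (rank t) + 0
    unchanged = trans (cong (count (χ (compress X))) (+-identityʳ (rank t))) (sym (+-identityʳ _))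
    step : ∀ ρ → τ x ≡ ρ → count (χ (compress X)) (rank t + bit (isKeep ρ)) ≡
                           count (χ (compress X)) (rank t) + bit (roleMember ρ X)
    step (keep i) τx≡i = begin
      count (χ (compress X)) (rank t + 1)
        ≡⟨ cong (count (χ (compress X))) (+-comm (rank t) 1) ⟩
      count (χ (compress X)) (suc (rank t))
        ≡⟨ count-snoc _ (rank t) ⟩
      count (χ (compress X)) (rank t) + bit (χ (compress X) (rank t))
        ≡⟨ cong (λ b → _ + bit b) (χ-compress X (rank t) (Ranked-bound at-x) at-x) ⟩
      count (χ (compress X)) (rank t) + bit (lookup X i) ∎
      where
      at-x : Ranked (rank t)
      at-x = record { pos = x ; label = i ; τ-pos = τx≡i ; rank-pos = cong rank (Fin.toℕ-fromℕ< t<n) }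
    step contract _ = unchanged
    step delete   _ = unchanged

  bounded⇔compress-bounded : ∀ X → Bounded d (embed τ X) ⇔ Bounded e (compress X)
  bounded⇔compress-bounded X = mk⇔ compressed decompressed
    where
    compressed : Bounded d (embed τ X) → Bounded e (compress X)
    compressed bY s _ = ⊓-glb (count≤ _ s) (minUpTo-greatest _ n λ t t≤n → begin
      count (χ (compress X)) s                           ≤⟨ count≤count+∸ _ (rank t) s ⟩
      count (χ (compress X)) (rank t) + (s ∸ rank t)     ≡⟨ cong (_+ (s ∸ rank t)) (count-compress X t t≤n) ⟨
      count (χ (embed τ X)) t + (s ∸ rank t)             ≤⟨ +-monoˡ-≤ _ (bY t t≤n) ⟩
      d t + (s ∸ rank t)                                 ∎)
      where open ≤-Reasoning
    decompressed : Bounded e (compress X) → Bounded d (embed τ X)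
    decompressed bC t t≤n = begin
      count (χ (embed τ X)) t                            ≡⟨ count-compress X t t≤n ⟩
      count (χ (compress X)) (rank t)                    ≤⟨ bC (rank t) (subst (rank t ≤_) (sym m+r≡κ) (rank≤κ t≤n)) ⟩
      e (rank t)                                         ≤⟨ m⊓n≤n _ _ ⟩
      minUpTo (λ t′ → d t′ + (rank t ∸ rank t′)) n       ≤⟨ minUpTo≤ _ t≤n ⟩
      d t + (rank t ∸ rank t)                            ≡⟨ cong (d t +_) (n∸n≡0 (rank t)) ⟩
      d t + 0                                            ≡⟨ +-identityʳ _ ⟩
      d t                                                ∎
      where open ≤-Reasoning

  bounded-e⇔bounded-Q : ∀ Z → Bounded e Z ⇔ Bounded (nUpTo Q) Z
  bounded-e⇔bounded-Q Z = mk⇔ (λ bZ s s≤ → subst (count (χ Z) s ≤_) (sym (nUpTo-Q s s≤)) (bZ s s≤))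
                              (λ bZ s s≤ → subst (count (χ Z) s ≤_) (nUpTo-Q s s≤) (bZ s s≤))
    where
    nUpTo-Q : ∀ s → s ≤ m + r → nUpTo Q s ≡ e s
    nUpTo-Q = nUpTo-pathOf e refl (hull-mono d rank n) (hull-step d rank n) (m + r)

  label-surjective : ∀ i → ∃ λ q → label q ≡ i
  label-surjective i = fromℕ< (Ranked-bound R) , ranked-unique (Fin.toℕ-fromℕ< (Ranked-bound R)) (ranked _ _) R
    where
    y : Fin n
    y = proj₁ (surj i)
    R : Ranked (rank (toℕ y))
    R = record { pos = y ; label = i ; τ-pos = proj₂ (surj i) ; rank-pos = refl }

  label-injective : ∀ {q q′} → label q ≡ label q′ → q ≡ q′
  label-injective {q} {q′} same =
    Fin.toℕ-injective (trans (sym (rank-pos R)) (trans (cong (rank ∘ toℕ) same-pos) (rank-pos R′)))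
    where
    open Ranked
    R : Ranked (toℕ q)
    R = ranked (toℕ q) _
    R′ : Ranked (toℕ q′)
    R′ = ranked (toℕ q′) _
    same-pos : pos R ≡ pos R′
    same-pos = inj (τ-pos R) (trans (τ-pos R′) (cong keep (sym same)))

  iso : Iso M′ (MPQ {m} {r} (EmNr m r) Q)
  iso = record { τ = keep ∘ label
               ; surj = λ i → proj₁ (label-surjective i) , cong keep (proj₂ (label-surjective i))
               ; inj = λ lq≡i lq′≡i → label-injective (keep-injective (trans lq≡i (sym lq′≡i)))
               ; indep = λ X → noContraction X
                   ⇔-∘ (⇔-sym (indep⇔bounded Q pathQ (compress X)) ⇔-∘ (bounded-e⇔bounded-Q (compress X)
                   ⇔-∘ (bounded⇔compress-bounded X ⇔-∘ indep⇔ X)))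
               }
      , λ q → label q , refl
    where
    noContraction : ∀ X → Indep (MPQ {m} {r} (EmNr m r) Q) (compress X) ⇔
                          (∃ λ B → IsBasisOf (MPQ {m} {r} (EmNr m r) Q) (contractSet (keep ∘ label)) B ×
                                   Indep (MPQ {m} {r} (EmNr m r) Q) (compress X ∪ B))
    noContraction = indep⇔minorIndep-noContraction (MPQ {m} {r} (EmNr m r) Q) (keep ∘ label) (λ _ → refl)
                                                   (MPQ-indep-∅ (EmNr m r) Q)

bounded-embedding⇒GenCatalan : ∀ {M′ A} (μ : Minor M′ A) d →
  (∀ X → Indep M′ X ⇔ Bounded {size A} d (embed (Minor.τ μ) X)) → GenCatalan M′
bounded-embedding⇒GenCatalan μ d indep⇔ = m , r , Q , pathQ , iso
  where open Compression μ d indep⇔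

-- Catalan matroids

data Parity : ℕ → Set where
  zero-p : Parity 0
  odd-p  : ∀ s → Parity (suc (s + s))
  even-p : ∀ s → Parity (suc (suc (s + s)))

parity : ∀ t → Parity t
parity zero          = zero-p
parity (suc zero)    = odd-p 0
parity (suc (suc t)) with parity t
... | zero-p   = even-p 0
... | odd-p s  = subst Parity (cong (suc ∘ suc) (+-suc s s)) (odd-p (suc s))
... | even-p s = subst Parity (cong (suc ∘ suc ∘ suc) (+-suc s s)) (even-p (suc s))

even-double : ∀ s → even (s + s) ≡ true
even-double zero    = refl
even-double (suc s) = trans (cong (even ∘ suc) (+-suc s s)) (even-double s)

even-suc-double : ∀ s → even (suc (s + s)) ≡ false
even-suc-double zero    = refl
even-suc-double (suc s) = trans (cong (even ∘ suc ∘ suc) (+-suc s s)) (even-suc-double s)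

⌊suc-double/2⌋ : ∀ s → ⌊ suc (s + s) /2⌋ ≡ s
⌊suc-double/2⌋ zero    = refl
⌊suc-double/2⌋ (suc s) = trans (cong (⌊_/2⌋ ∘ suc ∘ suc) (+-suc s s)) (cong suc (⌊suc-double/2⌋ s))

odd⇒suc-double : ∀ q → even q ≡ false → q ≡ suc (⌊ q /2⌋ + ⌊ q /2⌋)
odd⇒suc-double (suc zero)    _   = refl
odd⇒suc-double (suc (suc q)) odd = cong (suc ∘ suc) (trans (odd⇒suc-double q odd) (sym (+-suc ⌊ q /2⌋ ⌊ q /2⌋)))

count-odd : ∀ t → count (not ∘ even) t ≡ ⌊ t /2⌋
count-odd zero          = refl
count-odd (suc zero)    = refl
count-odd (suc (suc t)) = cong suc (count-odd t)

nUpTo-ENpow : ∀ n t → t ≤ n + n → nUpTo (ENpow n) t ≡ ⌊ t /2⌋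
nUpTo-ENpow n t t≤2n = trans (nUpTo≡count-north (ENpow n) t) (trans (count-cong t odd) (count-odd t))
  where
  isNorth-if : ∀ b → isNorth (if b then E else N) ≡ not b
  isNorth-if true  = refl
  isNorth-if false = refl
  odd : ∀ p → p < t → χ (northSet (ENpow n)) p ≡ not (even p)
  odd p p<t = begin
    χ (northSet (ENpow n)) p                             ≡⟨ χ-fromℕ< (northSet (ENpow n)) p p<2n ⟩
    lookup (northSet (ENpow n)) (fromℕ< p<2n)            ≡⟨ Vec.lookup-map _ isNorth (ENpow n) ⟩
    isNorth (lookup (ENpow n) (fromℕ< p<2n))             ≡⟨ cong isNorth (Vec.lookup∘tabulate _ (fromℕ< p<2n)) ⟩
    isNorth (if even (toℕ (fromℕ< p<2n)) then E else N)  ≡⟨ isNorth-if _ ⟩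
    not (even (toℕ (fromℕ< p<2n)))                       ≡⟨ cong (not ∘ even) (Fin.toℕ-fromℕ< p<2n) ⟩
    not (even p)                                         ∎
    where
    open ≡-Reasoning
    p<2n : p < n + n
    p<2n = <-≤-trans p<t t≤2n

ENpow-isPath : ∀ n → IsPath n n (ENpow n)
ENpow-isPath n = trans (countN≡nUpTo (ENpow n)) (trans (nUpTo-ENpow n (n + n) ≤-refl) (sym (n≡⌊n+n/2⌋ n)))

Catalan-GenCatalan : ∀ n → GenCatalan (Catalan n)
Catalan-GenCatalan n = n , n , ENpow n , ENpow-isPath n , Iso-refl (Catalan n) (MPQ-indep-∅ (EmNr n n) (ENpow n))

Catalan-isMatroid : ∀ n → IsMatroid (Catalan n)
Catalan-isMatroid n = IsMatroid-resp-⇔ (λ X → ⇔-sym (indep⇔bounded (ENpow n) (ENpow-isPath n) X))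
                                       (boundedSystem-isMatroid (n + n) (nUpTo (ENpow n)))

-- Element j sits at position 2j+2, an east step of (EN)^(L+1); the north step 2j+1
-- before it is contracted if Q_j = E and deleted if Q_j = N, and position 0 is deleted.
-- On the prefix of length 2s+1 the contracted steps use up exactly the s ∸ nUpTo Q s
-- east steps of Q, leaving room for nUpTo Q s elements.
module CatalanEmbedding {m r : ℕ} (Q : Vec Step (m + r)) (pathQ : IsPath m r Q) where

  L : ℕ
  L = m + r

  stepRole : Step → Role L
  stepRole E = contract
  stepRole N = delete

  northStepRole : ℕ → Role L
  northStepRole j with j <? L
  ... | yes j<L = stepRole (lookup Q (fromℕ< j<L))
  ... | no  _   = delete

  eastStepRole : ℕ → Role L
  eastStepRole j with j <? L
  ... | yes j<L = keep (fromℕ< j<L)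
  ... | no  _   = delete

  roleAt : ℕ → Role L
  roleAt zero    = delete
  roleAt (suc q) = if even q then northStepRole ⌊ q /2⌋ else eastStepRole ⌊ q /2⌋

  roleAt-odd : ∀ s → roleAt (suc (s + s)) ≡ northStepRole s
  roleAt-odd s rewrite even-double s = cong northStepRole (sym (n≡⌊n+n/2⌋ s))

  roleAt-even : ∀ s → roleAt (suc (suc (s + s))) ≡ eastStepRole s
  roleAt-even s rewrite even-suc-double s = cong eastStepRole (⌊suc-double/2⌋ s)

  northStepRole-notKeep : ∀ j {i} → northStepRole j ≢ keep i
  northStepRole-notKeep j with j <? L
  ... | no _    = λ ()
  ... | yes j<L with lookup Q (fromℕ< j<L)
  ...   | E = λ ()
  ...   | N = λ ()

  eastStepRole-keep⁻ : ∀ j {i} → eastStepRole j ≡ keep i → j ≡ toℕ i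
  eastStepRole-keep⁻ j with j <? L
  ... | yes j<L = λ eq → trans (sym (Fin.toℕ-fromℕ< j<L)) (cong toℕ (keep-injective eq))
  ... | no  _   = λ ()

  eastStepRole-toℕ : ∀ i → eastStepRole (toℕ i) ≡ keep i
  eastStepRole-toℕ i with toℕ i <? L
  ... | yes i<L = cong keep (Fin.fromℕ<-toℕ i i<L)
  ... | no  i≮L = contradiction (Fin.toℕ<n i) i≮L

  roleAt-keep⁻ : ∀ p {i} → roleAt p ≡ keep i → p ≡ suc (suc (toℕ i + toℕ i))
  roleAt-keep⁻ zero    ()
  roleAt-keep⁻ (suc q) {i} eq with even q in parity-q
  ... | true  = contradiction eq (northStepRole-notKeep ⌊ q /2⌋)
  ... | false = cong suc (trans (odd⇒suc-double q parity-q) (cong (λ j → suc (j + j)) (eastStepRole-keep⁻ ⌊ q /2⌋ eq)))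

  roleMember-northStepRole : ∀ j X → roleMember (northStepRole j) X ≡ false
  roleMember-northStepRole j X with j <? L
  ... | no _    = refl
  ... | yes j<L with lookup Q (fromℕ< j<L)
  ...   | E = refl
  ...   | N = refl

  roleMember-eastStepRole : ∀ j X → roleMember (eastStepRole j) X ≡ χ X j
  roleMember-eastStepRole j X with j <? L
  ... | yes j<L = sym (χ-fromℕ< X j j<L)
  ... | no  j≮L = sym (χ-beyond X j (≮⇒≥ j≮L))

  isContract-eastStepRole : ∀ j → isContract (eastStepRole j) ≡ false
  isContract-eastStepRole j with j <? L
  ... | yes _ = refl
  ... | no  _ = refl

  isContract-northStepRole : ∀ j → j < L → isContract (northStepRole j) ≡ not (χ (northSet Q) j)
  isContract-northStepRole j j<L with j <? L
  ... | no  j≮L = contradiction j<L j≮L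
  ... | yes j<L′ rewrite χ-fromℕ< (northSet Q) j j<L′ | Vec.lookup-map (fromℕ< j<L′) isNorth Q
    with lookup Q (fromℕ< j<L′)
  ...   | E = refl
  ...   | N = refl

  τ : Fin (suc L + suc L) → Role L
  τ = roleAt ∘ toℕ

  C : Subset (suc L + suc L)
  C = contractSet τ

  occupied : Subset L → ℕ → Bool
  occupied X p = roleMember (roleAt p) X ∨ isContract (roleAt p)

  χ-embed∪C : ∀ X p → p < suc L + suc L → χ (embed τ X ∪ C) p ≡ occupied X p
  χ-embed∪C X p p<size = begin
    χ (embed τ X ∪ C) p                                  ≡⟨ χ-∪ (embed τ X) C p ⟩
    χ (embed τ X) p ∨ χ C p                              ≡⟨ cong₂ _∨_ (χ-fromℕ< (embed τ X) p p<size) (χ-fromℕ< C p p<size) ⟩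
    lookup (embed τ X) x ∨ lookup C x                    ≡⟨ cong₂ _∨_ (lookup-embed τ X x) (lookup-contractSet τ x) ⟩
    roleMember (τ x) X ∨ isContract (τ x)                ≡⟨ cong (occupied X) (Fin.toℕ-fromℕ< p<size) ⟩
    occupied X p                                         ∎
    where
    open ≡-Reasoning
    x : Fin (suc L + suc L)
    x = fromℕ< p<size

  contracted : ℕ → Bool
  contracted j = isContract (northStepRole j)

  occupied-odd : ∀ X s → occupied X (suc (s + s)) ≡ contracted s
  occupied-odd X s rewrite roleAt-odd s | roleMember-northStepRole s X = refl

  occupied-even : ∀ X s → occupied X (suc (suc (s + s))) ≡ χ X s
  occupied-even X s rewrite roleAt-even s | roleMember-eastStepRole s X | isContract-eastStepRole s = ∨-identityʳ (χ X s)

  count-occupied-odd : ∀ X s → count (occupied X) (suc (s + s)) ≡ count (χ X) s + count contracted s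
  count-occupied-odd X zero    = refl
  count-occupied-odd X (suc s) = begin
    count (occupied X) (suc (suc s + suc s))
      ≡⟨ cong (count (occupied X) ∘ suc ∘ suc) (+-suc s s) ⟩
    count (occupied X) (suc (suc (suc (s + s))))
      ≡⟨ count-snoc (occupied X) (suc (suc (s + s))) ⟩
    count (occupied X) (suc (suc (s + s))) + bit (occupied X (suc (suc (s + s))))
      ≡⟨ cong₂ _+_ (count-snoc (occupied X) (suc (s + s))) (cong bit (occupied-even X s)) ⟩
    count (occupied X) (suc (s + s)) + bit (occupied X (suc (s + s))) + bit (χ X s)
      ≡⟨ cong₂ (λ c b → c + bit b + bit (χ X s)) (count-occupied-odd X s) (occupied-odd X s) ⟩
    count (χ X) s + count contracted s + bit (contracted s) + bit (χ X s)
      ≡⟨ regroup (count (χ X) s) (count contracted s) (bit (contracted s)) (bit (χ X s)) ⟩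
    (count (χ X) s + bit (χ X s)) + (count contracted s + bit (contracted s))
      ≡⟨ cong₂ _+_ (count-snoc (χ X) s) (count-snoc contracted s) ⟨
    count (χ X) (suc s) + count contracted (suc s) ∎
    where
    open ≡-Reasoning
    regroup : ∀ a b c d → a + b + c + d ≡ (a + d) + (b + c)
    regroup = solve 4 (λ a b c d → a :+ b :+ c :+ d := (a :+ d) :+ (b :+ c)) refl

  count-helper : ∀ s → s ≤ L → count contracted s + nUpTo Q s ≡ s
  count-helper s s≤L = begin
    count contracted s + nUpTo Q s
      ≡⟨ cong₂ _+_ (count-cong s (λ j j<s → isContract-northStepRole j (<-≤-trans j<s s≤L))) (nUpTo≡count-north Q s) ⟩
    count (not ∘ χ (northSet Q)) s + count (χ (northSet Q)) s
      ≡⟨ count-complement (χ (northSet Q)) s ⟩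
    s ∎
    where open ≡-Reasoning

  count-embed∪C : ∀ X t → t ≤ suc L + suc L → count (χ (embed τ X ∪ C)) t ≡ count (occupied X) t
  count-embed∪C X t t≤size = count-cong t (λ p p<t → χ-embed∪C X p (<-≤-trans p<t t≤size))

  ENpow-bound : ∀ t → t ≤ suc L + suc L → nUpTo (ENpow (suc L)) t ≡ ⌊ t /2⌋
  ENpow-bound = nUpTo-ENpow (suc L)

  odd≤size : ∀ s → s ≤ L → suc (s + s) ≤ suc L + suc L
  odd≤size s s≤L = s≤s (+-mono-≤ s≤L (m≤n⇒m≤1+n s≤L))

  half≤L : ∀ s → suc (s + s) ≤ suc L + suc L → s ≤ L
  half≤L s le with s ≤? L
  ... | yes s≤L = s≤L
  ... | no  s≰L = contradiction le (<⇒≱ (begin-strict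
    suc L + suc L  ≤⟨ +-mono-≤ (≰⇒> s≰L) (≰⇒> s≰L) ⟩
    s + s          <⟨ n<1+n _ ⟩
    suc (s + s)    ∎))
    where open ≤-Reasoning

  count-occupied-odd≤ : ∀ X → Bounded (nUpTo Q) X → ∀ s → s ≤ L → count (occupied X) (suc (s + s)) ≤ s
  count-occupied-odd≤ X bX s s≤L = begin
    count (occupied X) (suc (s + s))  ≡⟨ count-occupied-odd X s ⟩
    count (χ X) s + count contracted s    ≤⟨ +-monoˡ-≤ _ (bX s s≤L) ⟩
    nUpTo Q s + count contracted s        ≡⟨ +-comm (nUpTo Q s) _ ⟩
    count contracted s + nUpTo Q s        ≡⟨ count-helper s s≤L ⟩
    s                                 ∎
    where open ≤-Reasoning

  embed∪C-bounded : ∀ X → Bounded (nUpTo Q) X → Bounded (nUpTo (ENpow (suc L))) (embed τ X ∪ C)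
  embed∪C-bounded X bX t t≤size rewrite count-embed∪C X t t≤size | ENpow-bound t t≤size = by-parity (parity t) t≤size
    where
    by-parity : ∀ {t} → Parity t → t ≤ suc L + suc L → count (occupied X) t ≤ ⌊ t /2⌋
    by-parity zero-p     _  = z≤n
    by-parity (odd-p s)  le = subst (count (occupied X) (suc (s + s)) ≤_) (sym (⌊suc-double/2⌋ s))
                                    (count-occupied-odd≤ X bX s (half≤L s le))
    by-parity (even-p s) le = begin
      count (occupied X) (suc (suc (s + s)))
        ≡⟨ count-snoc (occupied X) (suc (s + s)) ⟩
      count (occupied X) (suc (s + s)) + bit (occupied X (suc (s + s)))
        ≤⟨ +-mono-≤ (count-occupied-odd≤ X bX s (half≤L s (≤-trans (n≤1+n _) le))) (bit≤1 _) ⟩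
      s + 1
        ≡⟨ +-comm s 1 ⟩
      suc s
        ≡⟨ cong suc (n≡⌊n+n/2⌋ s) ⟩
      suc ⌊ s + s /2⌋ ∎
      where open ≤-Reasoning

  embed∪C-bounded⁻ : ∀ X → Bounded (nUpTo (ENpow (suc L))) (embed τ X ∪ C) → Bounded (nUpTo Q) X
  embed∪C-bounded⁻ X bYC s s≤L = +-cancelʳ-≤ (count contracted s) _ _ (begin
    count (χ X) s + count contracted s                ≡⟨ count-occupied-odd X s ⟨
    count (occupied X) (suc (s + s))              ≡⟨ count-embed∪C X _ (odd≤size s s≤L) ⟨
    count (χ (embed τ X ∪ C)) (suc (s + s))       ≤⟨ bYC _ (odd≤size s s≤L) ⟩
    nUpTo (ENpow (suc L)) (suc (s + s))           ≡⟨ ENpow-bound _ (odd≤size s s≤L) ⟩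
    ⌊ suc (s + s) /2⌋                             ≡⟨ ⌊suc-double/2⌋ s ⟩
    s                                             ≡⟨ count-helper s s≤L ⟨
    count contracted s + nUpTo Q s                    ≡⟨ +-comm (count contracted s) _ ⟩
    nUpTo Q s + count contracted s                    ∎)
    where open ≤-Reasoning

  A K : IndepSystem
  A = MPQ {m} {r} (EmNr m r) Q
  K = Catalan (suc L)

  indep-K⇔ : ∀ Y → Indep K Y ⇔ Bounded (nUpTo (ENpow (suc L))) Y
  indep-K⇔ = indep⇔bounded {suc L} {suc L} (ENpow (suc L)) (ENpow-isPath (suc L))

  C-independent : Indep K C
  C-independent = IsMatroid.indep-⊆ (Catalan-isMatroid (suc L)) (q⊆p∪q (embed τ ⊥) C)
    (from (indep-K⇔ _) (embed∪C-bounded ⊥ (λ t _ → subst (_≤ nUpTo Q t) (sym (count-χ-⊥ L t)) z≤n)))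

  C-basis : IsBasisOf K C C
  C-basis = (λ x∈C → x∈C) , C-independent , λ B C⊆B B⊆C _ → ⊆-antisym B⊆C C⊆B

  surj : ∀ i → ∃ λ p → τ p ≡ keep i
  surj i = fromℕ< position<size , trans (cong roleAt (Fin.toℕ-fromℕ< position<size))
                                        (trans (roleAt-even (toℕ i)) (eastStepRole-toℕ i))
    where
    position<size : suc (suc (toℕ i + toℕ i)) < suc L + suc L
    position<size = s≤s (subst (suc (toℕ i + toℕ i) <_) (sym (+-suc L L))
                               (s≤s (+-mono-< (Fin.toℕ<n i) (Fin.toℕ<n i))))

  inj : ∀ {i p p′} → τ p ≡ keep i → τ p′ ≡ keep i → p ≡ p′
  inj {p = p} {p′} τp τp′ = Fin.toℕ-injective (trans (roleAt-keep⁻ (toℕ p) τp) (sym (roleAt-keep⁻ (toℕ p′) τp′)))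

  minor : Minor A K
  minor = record { τ = τ ; surj = surj ; inj = inj ; indep = λ X → mk⇔ (forward X) (backward X) }
    where
    forward : ∀ X → Indep A X → ∃ λ B → IsBasisOf K C B × Indep K (embed τ X ∪ B)
    forward X iX = C , C-basis , from (indep-K⇔ _) (embed∪C-bounded X (to (indep⇔bounded Q pathQ X) iX))
    backward : ∀ X → (∃ λ B → IsBasisOf K C B × Indep K (embed τ X ∪ B)) → Indep A X
    backward X (B , (B⊆C , _ , maximal) , iXB) = from (indep⇔bounded Q pathQ X) (embed∪C-bounded⁻ X
      (to (indep-K⇔ _) (subst (λ B′ → Indep K (embed τ X ∪ B′)) B≡C iXB)))
      where
      B≡C : B ≡ C
      B≡C = sym (maximal C B⊆C (λ x∈C → x∈C) C-independent)

-- The minor closure of the Catalan matroids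

GenCatalan-minorClosed : MinorClosed GenCatalan
GenCatalan-minorClosed M M′ _ (m , r , Q , pathQ , iso) ν =
  bounded-embedding⇒GenCatalan ν′ (contractBound (nUpTo Q) (contractSet (Minor.τ ν′))) (minor-of-bounded (nUpTo Q) ν′)
  where
  ν′ : Minor M′ (boundedSystem (m + r) (nUpTo Q))
  ν′ = Minor-resp-⇔ (indep⇔bounded Q pathQ) (Minor-respʳ-Iso iso (MPQ-indep-∅ (EmNr m r) Q) ν)

GenCatalan⇒Catalan-minor : ∀ M → GenCatalan M → ∃ λ n → Minor M (Catalan n)
GenCatalan⇒Catalan-minor M (m , r , Q , pathQ , iso) =
  suc (m + r) , Minor-respˡ-Iso iso (MPQ-indep-∅ (EmNr m r) Q) (CatalanEmbedding.minor Q pathQ)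

theorem4p2 : MinorClosed GenCatalan × (∀ n → GenCatalan (Catalan n)) ×
               ((P : IndepSystem → Set) → MinorClosed P → (∀ n → P (Catalan n)) →
                 ∀ M → GenCatalan M → P M)
theorem4p2 = GenCatalan-minorClosed , Catalan-GenCatalan , smallest
  where
  smallest : (P : IndepSystem → Set) → MinorClosed P → (∀ n → P (Catalan n)) → ∀ M → GenCatalan M → P M
  smallest P closed P-Catalan M genM with GenCatalan⇒Catalan-minor M genM
  ... | n , M≤Catalan = closed (Catalan n) M (Catalan-isMatroid n) (P-Catalan n) M≤Catalan
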